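{- Let $G$ be a bridgeless cubic graph. Then $G$ has an FR-triple if and only if $G$ has two disjoint matchings $A_1$ and $A_2$ such that $A_1\cup A_2$ forms a union of vertex-disjoint cycles and at least one of $\overline{G_{A_1}}$, $\overline{G_{A_2}}$ is $3$-edge colourable.
   Context: An FR-triple of $G$ is an ordered triple $(M_1,M_2,M_3)$ of perfect matchings of $G$ with $M_1\cap M_2\cap M_3=\emptyset$. Splitting: let $A_1,A_2$ be disjoint matchings of the cubic graph $G$ such that $A_1\cup A_2$ is a union of vertex-disjoint cycles (these cycles alternate between $A_1$ and $A_2$, so every endpoint of an edge of $A_1\cup A_2$ is incident with exactly one edge of $A_1$, one edge of $A_2$, and one further edge, called its third edge). For $\{i,j\}=\{1,2\}$, $G_{A_i}$ is obtained from $G$ by, for every edge $ab\in A_i$, replacing $a$ by two new vertices $a'$ (incident with the third edge formerly at $a$) and $a''$ (incident with the $A_j$-edge formerly at $a$), replacing $b$ likewise by $b',b''$, and replacing $ab$ by the two edges $a'b'$ and $a''b''$. $\overline{G_{A_i}}$ is obtained from $G_{A_i}$ by suppressing degree-$2$ vertices: each maximal path whose internal vertices have degree $2$ becomes a single edge, and each cycle all of whose vertices have degree $2$ becomes a vertexless loop (one edge, no vertex). The components of $\overline{G_{A_i}}$ are cubic (multi)graphs and vertexless loops; $\overline{G_{A_i}}$ is called $3$-edge colourable if each of its cubic components is $3$-edge colourable. -}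

module Defs where

open import Data.Nat using (ℕ; zero; suc; _+_; _≤_; _≤?_)
open import Data.Nat.Properties using () renaming (_≟_ to _≟ℕ_)
open import Data.Bool using (Bool; true; false; if_then_else_; _∧_; _∨_)
open import Data.Fin using (Fin)
open import Data.List using (List; []; _∷_; length; lookup; map; allFin; concatMap)
open import Data.Nat.ListAction using (sum)
open import Data.List.Membership.Propositional using (_∈_)
open import Data.List.Relation.Unary.Unique.Propositional using (Unique)
open import Data.List.Relation.Binary.Permutation.Propositional using (_↭_)
open import Data.Product using (Σ; ∃; ∃-syntax; _×_; _,_; proj₁; proj₂)
open import Data.Product.Properties using (≡-dec)
open import Data.Sum using (_⊎_)
open import Relation.Nullary using (¬_)
open import Relation.Nullary.Decidable using (isYes)
open import Relation.Binary.Definitions using (DecidableEquality)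
open import Relation.Binary.PropositionalEquality using (_≡_; _≢_; refl)
open import Relation.Binary.Construct.Closure.ReflexiveTransitive using (Star)

-- Finite multigraphs (parallel edges and loops allowed) together with a
-- number of "vertexless loops" (edges without vertices, produced by
-- suppressing cycles of degree-2 vertices).

record MGraph (V : Set) : Set where
  constructor mkGraph
  field
    verts : List V
    edges : List (V × V)
    loops : ℕ

open MGraph public

module _ {V : Set} where

  Edge : MGraph V → Set
  Edge H = Fin (length (edges H))

  ends : (H : MGraph V) → Edge H → V × V
  ends H e = lookup (edges H) e

  Inc : (H : MGraph V) → V → Edge H → Set
  Inc H v e = proj₁ (ends H e) ≡ v ⊎ proj₂ (ends H e) ≡ v

  Adjacent : (H : MGraph V) → Edge H → Edge H → Set
  Adjacent H e f = ∃[ v ] (Inc H v e × Inc H v f)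

  WellFormed : MGraph V → Set
  WellFormed H = Unique (verts H)
               × (∀ e → proj₁ (ends H e) ∈ verts H × proj₂ (ends H e) ∈ verts H)

  StepAvoiding : (H : MGraph V) → Edge H → V → V → Set
  StepAvoiding H e u w = ∃[ f ] (f ≢ e × (ends H f ≡ (u , w) ⊎ ends H f ≡ (w , u)))

  IsBridge : (H : MGraph V) → Edge H → Set
  IsBridge H e = ¬ Star (StepAvoiding H e) (proj₁ (ends H e)) (proj₂ (ends H e))

  Bridgeless : MGraph V → Set
  Bridgeless H = ∀ e → ¬ IsBridge H e

  -- proper 3-edge-colouring of the edges carrying vertices (vertexless
  -- loops impose no condition); a graph with a loop has none.
  ProperEdgeColouring : (H : MGraph V) → (Edge H → Fin 3) → Set
  ProperEdgeColouring H c =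
      (∀ e → proj₁ (ends H e) ≢ proj₂ (ends H e))
    × (∀ e f → e ≢ f → Adjacent H e f → c e ≢ c f)

  ThreeEdgeColourable : MGraph V → Set
  ThreeEdgeColourable H = ∃[ c ] ProperEdgeColouring H c

  EdgeSet : MGraph V → Set
  EdgeSet H = Edge H → Bool

  unionₑ : (H : MGraph V) → EdgeSet H → EdgeSet H → EdgeSet H
  unionₑ H A B e = A e ∨ B e

  DisjointEdgeSets : (H : MGraph V) → EdgeSet H → EdgeSet H → Set
  DisjointEdgeSets H A B = ∀ e → (A e ∧ B e) ≡ false

  EdgeAt : V → V → V × V → Set
  EdgeAt v x p = p ≡ (v , x) ⊎ p ≡ (x , v)

module WithDecEq {V : Set} (_≟_ : DecidableEquality V) where

  -- number of ends of the edge (x , y) equal to v (a loop counts twice)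
  endCount : V → V × V → ℕ
  endCount v (x , y) = (if isYes (x ≟ v) then 1 else 0) + (if isYes (y ≟ v) then 1 else 0)

  degreeIn : (H : MGraph V) → EdgeSet H → V → ℕ
  degreeIn H S v = sum (map (λ e → if S e then endCount v (ends H e) else 0) (allFin _))

  degree : (H : MGraph V) → V → ℕ
  degree H = degreeIn H (λ _ → true)

  Cubic : MGraph V → Set
  Cubic H = ∀ v → v ∈ verts H → degree H v ≡ 3

  Matching : (H : MGraph V) → EdgeSet H → Set
  Matching H M = ∀ v → v ∈ verts H → degreeIn H M v ≤ 1

  PerfectMatching : (H : MGraph V) → EdgeSet H → Set
  PerfectMatching H M = ∀ v → v ∈ verts H → degreeIn H M v ≡ 1

  FRTriple : MGraph V → Set
  FRTriple H = Σ (EdgeSet H) λ M₁ → Σ (EdgeSet H) λ M₂ → Σ (EdgeSet H) λ M₃ →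
      PerfectMatching H M₁ × PerfectMatching H M₂ × PerfectMatching H M₃
    × (∀ e → (M₁ e ∧ M₂ e ∧ M₃ e) ≡ false)

  UnionOfDisjointCycles : (H : MGraph V) → EdgeSet H → Set
  UnionOfDisjointCycles H S = ∀ v → v ∈ verts H → degreeIn H S v ≡ 0 ⊎ degreeIn H S v ≡ 2

  -- one suppression step: remove a degree-2 vertex v.
  --  * if its two edge-ends belong to two different edges vx and vy, these are
  --    replaced by a single edge xy (a loop if x = y);
  --  * if they belong to a loop at v, that loop becomes a vertexless loop.
  SuppressStep : MGraph V → MGraph V → Set
  SuppressStep H H' = ∃[ v ]
      ( v ∈ verts H × degree H v ≡ 2 × verts H ↭ (v ∷ verts H')
      × ( (∃[ x ] ∃[ y ] ∃[ e₁ ] ∃[ e₂ ] ∃[ rest ]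
             ( EdgeAt v x e₁ × EdgeAt v y e₂
             × edges H ↭ (e₁ ∷ e₂ ∷ rest)
             × edges H' ↭ ((x , y) ∷ rest)
             × loops H' ≡ loops H))
        ⊎ (∃[ rest ]
             ( edges H ↭ ((v , v) ∷ rest)
             × edges H' ↭ rest
             × loops H' ≡ suc (loops H)))))

  SuppressionOf : MGraph V → MGraph V → Set
  SuppressionOf K H = Star SuppressStep K H × (∀ v → v ∈ verts H → ¬ (degree H v ≡ 2))

  SuppressedThreeEdgeColourable : MGraph V → Set
  SuppressedThreeEdgeColourable K = ∃[ H ] (SuppressionOf K H × ThreeEdgeColourable H)

-- Splitting.  Vertices of G are labelled by ℕ; a vertex a of G that is
-- split becomes (a , ′) and (a , ″); an unsplit vertex a becomes (a , o).

data Tag : Set where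
  o ′ ″ : Tag

_≟Tag_ : DecidableEquality Tag
o ≟Tag o = Relation.Nullary.yes refl
o ≟Tag ′ = Relation.Nullary.no λ ()
o ≟Tag ″ = Relation.Nullary.no λ ()
′ ≟Tag o = Relation.Nullary.no λ ()
′ ≟Tag ′ = Relation.Nullary.yes refl
′ ≟Tag ″ = Relation.Nullary.no λ ()
″ ≟Tag o = Relation.Nullary.no λ ()
″ ≟Tag ′ = Relation.Nullary.no λ ()
″ ≟Tag ″ = Relation.Nullary.yes refl

_≟S_ : DecidableEquality (ℕ × Tag)
_≟S_ = ≡-dec _≟ℕ_ _≟Tag_

open WithDecEq public

split : (G : MGraph ℕ) → EdgeSet G → EdgeSet G → MGraph (ℕ × Tag)
split G Ai Aj = mkGraph vs es 0
  where
  cov : ℕ → Bool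
  cov a = isYes (1 ≤? degreeIn _≟ℕ_ G Ai a)

  vs : List (ℕ × Tag)
  vs = concatMap (λ a → if cov a then (a , ′) ∷ (a , ″) ∷ [] else (a , o) ∷ []) (verts G)

  lab : Edge G → ℕ → ℕ × Tag
  lab e a = if cov a then (if Aj e then (a , ″) else (a , ′)) else (a , o)

  newEdges : Edge G → List ((ℕ × Tag) × (ℕ × Tag))
  newEdges e with ends G e
  ... | (a , b) = if Ai e then ((a , ′) , (b , ′)) ∷ ((a , ″) , (b , ″)) ∷ []
                           else (lab e a , lab e b) ∷ []

  es : List ((ℕ × Tag) × (ℕ × Tag))
  es = concatMap newEdges (allFin _)

-- A 3-edge-colouring of the graph obtained from G_{A_i} by suppressing its
-- degree-2 vertices is the same as a 3-colouring of the edges of G_{A_i} in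
-- which the two edges at every degree-2 vertex share a colour and the edges at
-- any other vertex get distinct colours, since this property is invariant under
-- each suppression step. Such a colouring amounts to a colour α(e) for every
-- edge e of G and a colour β(e) for the second copy of every edge of A_i,
-- subject to conditions at each vertex of G involving only its three edges
-- (a bridgeless cubic graph is loopless).
--
-- From such colours, putting each edge of A_i into the two perfect matchings
-- other than its colour, each edge of A_j into none, and every other edge into
-- the matching of its colour gives an FR-triple. Conversely, for an FR-triple
-- let A₁ consist of the edges in two of the matchings and A₂ of those in none,
-- and colour an edge of A₁ by the matching missing it and an edge lying in a
-- single matching by that matching. Both verifications are local and finite, and
-- are done by enumerating the configurations at a vertex.

module Submission where

open import Defs
open import Data.Nat using (ℕ; zero; suc; _+_; _≤_; _<_; _≤?_; _≡ᵇ_; _≤ᵇ_; z≤n; s≤s)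
open import Data.Nat.Properties
  using ( _≟_; +-0-commutativeMonoid; +-commutativeSemigroup; +-assoc; +-comm; +-identityʳ; +-mono-≤; +-monoʳ-≤; +-cancelˡ-≡
        ; m≤m+n; m≤n+m; m+n≡0⇒n≡0; ≤-trans; ≤-reflexive; 1+n≰n; n≤0⇒n≡0; ≮⇒≥
        ; ≡ᵇ⇒≡; ≡⇒≡ᵇ; ≤ᵇ⇒≤; ≤⇒≤ᵇ; module ≤-Reasoning)
  renaming (suc-injective to ℕ-suc-injective)
open import Algebra.Properties.CommutativeSemigroup +-commutativeSemigroup using (x∙yz≈y∙xz)
open import Algebra.Properties.CommutativeMonoid.Sum +-0-commutativeMonoid
  using (sum-cong-≗; sum-replicate-zero; ∑-distrib-+) renaming (sum to ∑)
open import Data.Fin using (Fin; zero; suc) renaming (_≟_ to _≟ᶠ_)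
open import Data.Fin.Properties using (suc-injective)
open import Data.Bool using (Bool; true; false; if_then_else_; _∧_; _∨_; not; T)
open import Data.Bool.Properties using (T-∧; T-∨; T-not-≡; ∨-comm)
open import Data.Bool.ListAction using (all)
open import Data.List using (List; []; _∷_; _++_; map; tabulate; allFin; lookup; length; concat; concatMap; zip; cartesianProduct)
open import Data.List.Properties
  using (map-tabulate; map-∘; length-map; ∷-injective; map-++; tabulate-lookup; map-concatMap; concatMap-cong; tabulate-cong; map-cong)
open import Data.Nat.ListAction using (sum)
open import Data.Nat.ListAction.Properties using (sum-++; sum-↭)
open import Data.List.Membership.Propositional using (_∈_; find; lose)
open import Data.List.Membership.Propositional.Properties
  using (∈-map⁺; ∈-map⁻; ∈-∃++; ∈-allFin; ∈-cartesianProduct⁺; ∈-concatMap⁺; ∈-concatMap⁻)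
open import Data.List.Membership.DecPropositional _≟_ using (_∈?_)
open import Data.List.Relation.Unary.Any using (here; there; any?)
import Data.List.Relation.Unary.All as All
open import Data.List.Relation.Unary.All.Properties using (all⁺)
open import Data.List.Relation.Binary.Permutation.Propositional using (_↭_; ↭-sym; ↭-trans; ↭-refl; ↭-reflexive; prep; swap)
open import Data.List.Relation.Binary.Permutation.Propositional.Properties using (map⁺; ↭-map-inv; ∈-resp-↭; ↭-length; shift)
open import Data.Product using (Σ; ∃-syntax; _×_; _,_; proj₁; proj₂)
open import Data.Sum using (_⊎_; inj₁; inj₂)
import Data.Sum
open import Data.Empty using (⊥; ⊥-elim)
open import Function using (_∘_; id; case_of_; _⇔_; mk⇔; Equivalence)
open import Function.Properties.Equivalence using () renaming (refl to ⇔-refl; sym to ⇔-sym; trans to ⇔-trans)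
open import Relation.Nullary using (¬_; Dec; does; yes; no)
open import Relation.Nullary.Decidable using (isYes; dec-true)
open import Relation.Binary.Definitions using (DecidableEquality)
open import Relation.Binary.PropositionalEquality
open import Relation.Binary.Construct.Closure.ReflexiveTransitive using (Star; ε; _◅_)

private variable n : ℕ

∑-tabulate : (f : Fin n → ℕ) → sum (tabulate f) ≡ ∑ f
∑-tabulate {zero}  f = refl
∑-tabulate {suc n} f = cong (f zero +_) (∑-tabulate (f ∘ suc))

∑-allFin : (f : Fin n → ℕ) → sum (map f (allFin n)) ≡ ∑ f
∑-allFin f = trans (cong sum (map-tabulate id f)) (∑-tabulate f)

∑-lookup : {A : Set} (f : A → ℕ) (xs : List A) → ∑ (f ∘ lookup xs) ≡ sum (map f xs)
∑-lookup f []       = refl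
∑-lookup f (x ∷ xs) = cong (f x +_) (∑-lookup f xs)

∑-zero : {f : Fin n → ℕ} → (∀ i → f i ≡ 0) → ∑ f ≡ 0
∑-zero {n} f≗0 = trans (sum-cong-≗ f≗0) (sum-replicate-zero n)

term≤∑ : (f : Fin n → ℕ) (i : Fin n) → f i ≤ ∑ f
term≤∑ f zero    = m≤m+n (f zero) _
term≤∑ f (suc i) = ≤-trans (term≤∑ (f ∘ suc) i) (m≤n+m _ (f zero))

pair≤∑ : (f : Fin n → ℕ) {i j : Fin n} → i ≢ j → f i + f j ≤ ∑ f
pair≤∑ f {zero}  {zero}  i≢j = ⊥-elim (i≢j refl)
pair≤∑ f {zero}  {suc j} _   = +-monoʳ-≤ (f zero) (term≤∑ (f ∘ suc) j)
pair≤∑ f {suc i} {zero}  _   =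
  subst (_≤ ∑ f) (+-comm (f zero) (f (suc i))) (+-monoʳ-≤ (f zero) (term≤∑ (f ∘ suc) i))
pair≤∑ f {suc i} {suc j} i≢j =
  ≤-trans (pair≤∑ (f ∘ suc) (i≢j ∘ cong suc)) (m≤n+m _ (f zero))

∑≤1 : (f : Fin n → ℕ) → (∀ i → f i ≤ 1) → (∀ {i j} → i ≢ j → 0 < f i → 0 < f j → ⊥) → ∑ f ≤ 1
∑≤1 {zero}  f _     _         = z≤n
∑≤1 {suc n} f f≤1 exclusive with f zero in eq
... | zero        = ∑≤1 (f ∘ suc) (f≤1 ∘ suc) (λ i≢j → exclusive (i≢j ∘ suc-injective))
... | suc zero    = s≤s (≤-reflexive (∑-zero rest≡0))
  where
  rest≡0 : ∀ i → f (suc i) ≡ 0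
  rest≡0 i with f (suc i) in eq′
  ... | zero  = refl
  ... | suc _ = ⊥-elim (exclusive (λ ()) (subst (0 <_) (sym eq) (s≤s z≤n)) (subst (0 <_) (sym eq′) (s≤s z≤n)))
... | suc (suc _) with s≤s () ← subst (_≤ 1) eq (f≤1 zero)

_except_ : (Fin n → ℕ) → Fin n → Fin n → ℕ
(f except j) i = if does (i ≟ᶠ j) then 0 else f i

except-≢ : (f : Fin n → ℕ) {i j : Fin n} → i ≢ j → (f except j) i ≡ f i
except-≢ f {i} {j} i≢j with i ≟ᶠ j
... | yes i≡j = ⊥-elim (i≢j i≡j)
... | no  _   = refl

except-self : (f : Fin n → ℕ) (j : Fin n) → (f except j) j ≡ 0
except-self f j with j ≟ᶠ j
... | yes _   = refl
... | no j≢j = ⊥-elim (j≢j refl)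

∑-except : (f : Fin n → ℕ) (j : Fin n) → ∑ f ≡ f j + ∑ (f except j)
∑-except {suc n} f zero    = cong (f zero +_) (sum-cong-≗ {n} λ _ → refl)
∑-except f (suc j) = begin
  f zero + ∑ (f ∘ suc)                              ≡⟨ cong (f zero +_) (∑-except (f ∘ suc) j) ⟩
  f zero + (f (suc j) + ∑ ((f ∘ suc) except j))     ≡⟨ x∙yz≈y∙xz (f zero) (f (suc j)) _ ⟩
  f (suc j) + (f zero + ∑ ((f ∘ suc) except j))     ∎
  where open ≡-Reasoning

𝟙 : Bool → ℕ
𝟙 b = if b then 1 else 0

∑-point : (j : Fin n) (c : ℕ) → ∑ (λ i → if does (j ≟ᶠ i) then c else 0) ≡ c
∑-point {suc n} zero    c = trans (cong (c +_) (∑-zero {n} λ _ → refl)) (+-identityʳ c)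
∑-point {suc n} (suc j) c = ∑-point j c

record Support (f : Fin n → ℕ) : Set where
  field
    points    : List (Fin n)
    size      : length points ≡ ∑ f
    at-points : ∀ {i} → i ∈ points → f i ≡ 1
    complete  : ∀ {i} → 0 < f i → i ∈ points
    ∑-over    : (g : Fin n → ℕ) → (∀ i → f i ≡ 0 → g i ≡ 0) → ∑ g ≡ sum (map g points)

support : (f : Fin n → ℕ) → (∀ i → f i ≤ 1) → Support f
support {zero}  f _   = record
  { points = [] ; size = refl ; at-points = λ () ; complete = λ { {()} } ; ∑-over = λ _ _ → refl }
support {suc n} f f≤1 with f zero in eq | support (f ∘ suc) (f≤1 ∘ suc)
... | zero  | S = record
  { points    = map suc points
  ; size      = trans (trans (length-map suc points) size) (cong (_+ ∑ (f ∘ suc)) (sym eq))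
  ; at-points = λ i∈ → let (j , j∈ , i≡) = ∈-map⁻ suc i∈ in trans (cong f i≡) (at-points j∈)
  ; complete  = λ { {zero} 0<f0 → ⊥-elim (1+n≰n (subst (0 <_) eq 0<f0)) ; {suc i} 0<fi → ∈-map⁺ suc (complete 0<fi) }
  ; ∑-over    = λ g vanish → trans (cong (_+ ∑ (g ∘ suc)) (vanish zero eq))
                                   (trans (∑-over (g ∘ suc) (vanish ∘ suc)) (cong sum (map-∘ points))) }
  where open Support S
... | suc zero | S = record
  { points    = zero ∷ map suc points
  ; size      = trans (cong suc (trans (length-map suc points) size)) (cong (_+ ∑ (f ∘ suc)) (sym eq))
  ; at-points = λ { (here refl) → eq ; (there i∈) → let (j , j∈ , i≡) = ∈-map⁻ suc i∈ in trans (cong f i≡) (at-points j∈) }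
  ; complete  = λ { {zero} _ → here refl ; {suc i} 0<fi → there (∈-map⁺ suc (complete 0<fi)) }
  ; ∑-over    = λ g vanish → cong (g zero +_) (trans (∑-over (g ∘ suc) (vanish ∘ suc)) (cong sum (map-∘ points))) }
  where open Support S
... | suc (suc _) | _ with s≤s () ← subst (_≤ 1) eq (f≤1 zero)

support-one : {f : Fin n → ℕ} → (∀ i → f i ≤ 1) → ∑ f ≡ 1 → ∃[ j ] (f j ≡ 1 × (∀ {i} → 0 < f i → i ≡ j))
support-one f≤1 one with support _ f≤1
... | record { points = j ∷ [] ; at-points = at ; complete = complete } =
  j , at (here refl) , λ pos → case complete pos of λ { (here i≡j) → i≡j }
... | record { points = [] ; size = size } with () ← trans size one
... | record { points = _ ∷ _ ∷ _ ; size = size } with () ← trans size one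

record Support₃ (f : Fin n → ℕ) : Set where
  field
    e₁ e₂ e₃ : Fin n
    once₁    : f e₁ ≡ 1
    once₂    : f e₂ ≡ 1
    once₃    : f e₃ ≡ 1
    ∑-local  : (g : Fin n → ℕ) → (∀ i → f i ≡ 0 → g i ≡ 0) → ∑ g ≡ g e₁ + (g e₂ + g e₃)

support-three : {f : Fin n → ℕ} → (∀ i → f i ≤ 1) → ∑ f ≡ 3 → Support₃ f
support-three f≤1 three with support _ f≤1
... | record { points = e₁ ∷ e₂ ∷ e₃ ∷ [] ; at-points = at ; ∑-over = over } = record
  { e₁ = e₁ ; e₂ = e₂ ; e₃ = e₃
  ; once₁ = at (here refl) ; once₂ = at (there (here refl)) ; once₃ = at (there (there (here refl)))
  ; ∑-local = λ g vanish → trans (over g vanish) (cong (λ x → g e₁ + (g e₂ + x)) (+-identityʳ (g e₃))) }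
... | record { points = [] ; size = size } with () ← trans size three
... | record { points = _ ∷ [] ; size = size } with () ← trans size three
... | record { points = _ ∷ _ ∷ [] ; size = size } with () ← trans size three
... | record { points = _ ∷ _ ∷ _ ∷ _ ∷ _ ; size = size } with () ← trans size three

map-++-inv : {A B : Set} (f : A → B) (Z : List A) (xs ys : List B) → map f Z ≡ xs ++ ys →
             ∃[ Z₁ ] ∃[ Z₂ ] (Z ≡ Z₁ ++ Z₂ × map f Z₁ ≡ xs × map f Z₂ ≡ ys)
map-++-inv f Z       []       ys eq = [] , Z , refl , refl , eq
map-++-inv f (z ∷ Z) (x ∷ xs) ys eq with ∷-injective eq
... | fz≡x , eq′ with map-++-inv f Z xs ys eq′
... | Z₁ , Z₂ , refl , eq₁ , eq₂ = z ∷ Z₁ , Z₂ , refl , cong₂ _∷_ fz≡x eq₁ , eq₂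

map-concat-inv : {A B : Set} (f : A → B) (g : Fin n → List B) (Z : List A) → map f Z ≡ concat (tabulate g) →
                 ∃[ h ] ((∀ i → map f (h i) ≡ g i) × Z ≡ concat (tabulate h))
map-concat-inv {zero}  f g [] _  = (λ ()) , (λ ()) , refl
map-concat-inv {suc n} f g Z  eq with map-++-inv f Z (g zero) (concat (tabulate (g ∘ suc))) eq
... | Z₁ , Z₂ , refl , eq₁ , eq₂ with map-concat-inv f (g ∘ suc) Z₂ eq₂
... | h , eqs , refl = (λ { zero → Z₁ ; (suc i) → h i }) , (λ { zero → eq₁ ; (suc i) → eqs i }) , refl

sum-map-concatMap : {A B : Set} (f : B → ℕ) (g : A → List B) (xs : List A) →
                    sum (map f (concatMap g xs)) ≡ sum (map (λ x → sum (map f (g x))) xs)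
sum-map-concatMap f g []       = refl
sum-map-concatMap f g (x ∷ xs) = begin
  sum (map f (g x ++ concatMap g xs))                ≡⟨ cong sum (map-++ f (g x) (concatMap g xs)) ⟩
  sum (map f (g x) ++ map f (concatMap g xs))         ≡⟨ sum-++ (map f (g x)) _ ⟩
  sum (map f (g x)) + sum (map f (concatMap g xs))    ≡⟨ cong (sum (map f (g x)) +_) (sum-map-concatMap f g xs) ⟩
  sum (map f (g x)) + sum (map (λ x → sum (map f (g x))) xs) ∎
  where open ≡-Reasoning

-- Colourings surviving the suppression of degree-2 vertices

validCountsᵇ : (suppressible : Bool) → ℕ → ℕ → ℕ → Bool
validCountsᵇ true  c₀ c₁ c₂ = (c₀ ≡ᵇ 2) ∨ (c₁ ≡ᵇ 2) ∨ (c₂ ≡ᵇ 2)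
validCountsᵇ false c₀ c₁ c₂ = (c₀ ≤ᵇ 1) ∧ (c₁ ≤ᵇ 1) ∧ (c₂ ≤ᵇ 1)

module Suppression {V : Set} (_≟ᵥ_ : DecidableEquality V) where

  ec : V → V × V → ℕ
  ec = endCount _≟ᵥ_

  same : V → V → Bool
  same x y = isYes (x ≟ᵥ y)

  same-refl : ∀ x → same x x ≡ true
  same-refl x with x ≟ᵥ x
  ... | yes _ = refl
  ... | no x≢x = ⊥-elim (x≢x refl)

  same-≢ : ∀ {x y} → x ≢ y → same x y ≡ false
  same-≢ {x} {y} x≢y with x ≟ᵥ y
  ... | yes x≡y = ⊥-elim (x≢y x≡y)
  ... | no _ = refl

  endCount-loop : ∀ {v p} → proj₁ p ≡ v → proj₂ p ≡ v → ec v p ≡ 2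
  endCount-loop {v} refl refl rewrite same-refl v = refl

  endCount-loop-away : ∀ {w v} → w ≢ v → ec w (v , v) ≡ 0
  endCount-loop-away w≢v rewrite same-≢ (w≢v ∘ sym) = refl

  endCount-at : ∀ {v x e} → EdgeAt v x e → ec v e ≡ suc (𝟙 (same x v))
  endCount-at {v} {x} (inj₁ refl) rewrite same-refl v = refl
  endCount-at {v} {x} (inj₂ refl) rewrite same-refl v = +-comm (𝟙 (same x v)) 1

  endCount-away : ∀ {w v x e} → w ≢ v → EdgeAt v x e → ec w e ≡ 𝟙 (same x w)
  endCount-away w≢v (inj₁ refl) rewrite same-≢ (w≢v ∘ sym) = refl
  endCount-away w≢v (inj₂ refl) rewrite same-≢ (w≢v ∘ sym) = +-identityʳ _

  endCount-positive : ∀ v p → 0 < ec v p → proj₁ p ≡ v ⊎ proj₂ p ≡ v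
  endCount-positive v (x , y) pos with x ≟ᵥ v | y ≟ᵥ v
  ... | yes x≡v | _       = inj₁ x≡v
  ... | no _    | yes y≡v = inj₂ y≡v
  ... | no _    | no _    with () ← pos

  endCount-incident : ∀ v p → proj₁ p ≡ v ⊎ proj₂ p ≡ v → 0 < ec v p
  endCount-incident v (.v , y) (inj₁ refl) rewrite same-refl v = s≤s z≤n
  endCount-incident v (x , .v) (inj₂ refl) rewrite same-refl v = m≤n+m 1 _

  endCount-nonLoop : ∀ v p → proj₁ p ≢ proj₂ p → ec v p ≤ 1
  endCount-nonLoop v (x , y) x≢y with x ≟ᵥ v | y ≟ᵥ v
  ... | yes refl | yes refl = ⊥-elim (x≢y refl)
  ... | yes _    | no _     = s≤s z≤n
  ... | no _     | yes _    = s≤s z≤n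
  ... | no _     | no _     = z≤n

  endSum : List (V × V) → V → ℕ
  endSum es v = sum (map (ec v) es)

  endSum-↭ : ∀ {es es′} → es ↭ es′ → ∀ v → endSum es v ≡ endSum es′ v
  endSum-↭ p v = sum-↭ (map⁺ (ec v) p)

  degree≡endSum : ∀ K v → degree _≟ᵥ_ K v ≡ endSum (edges K) v
  degree≡endSum K v = trans (∑-allFin (ec v ∘ lookup (edges K))) (∑-lookup (ec v) (edges K))

  ColouredEdge : Set
  ColouredEdge = (V × V) × Fin 3

  colourDegree : List ColouredEdge → V → Fin 3 → ℕ
  colourDegree CL v k = sum (map (λ ce → if does (proj₂ ce ≟ᶠ k) then ec v (proj₁ ce) else 0) CL)

  colourDegree-↭ : ∀ {CL CL′} → CL ↭ CL′ → ∀ v k → colourDegree CL v k ≡ colourDegree CL′ v k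
  colourDegree-↭ p v k = sum-↭ (map⁺ _ p)

  endSum≡∑colourDegree : ∀ CL v → endSum (map proj₁ CL) v ≡ ∑ (colourDegree CL v)
  endSum≡∑colourDegree []              v = sym (∑-zero {3} λ _ → refl)
  endSum≡∑colourDegree ((p , c) ∷ CL) v = begin
    ec v p + endSum (map proj₁ CL) v               ≡⟨ cong₂ _+_ (sym (∑-point c (ec v p))) (endSum≡∑colourDegree CL v) ⟩
    ∑ (coloured c (ec v p)) + ∑ (colourDegree CL v) ≡⟨ ∑-distrib-+ (coloured c (ec v p)) (colourDegree CL v) ⟨
    ∑ (colourDegree ((p , c) ∷ CL) v)              ∎
    where
    open ≡-Reasoning
    coloured : Fin 3 → ℕ → Fin 3 → ℕ
    coloured c n k = if does (c ≟ᶠ k) then n else 0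

  colourDegree≤endSum : ∀ CL v k → colourDegree CL v k ≤ endSum (map proj₁ CL) v
  colourDegree≤endSum CL v k = ≤-trans (term≤∑ (colourDegree CL v) k) (≤-reflexive (sym (endSum≡∑colourDegree CL v)))

  degree≡∑colourDegree : ∀ K {CL} → map proj₁ CL ↭ edges K → ∀ v → degree _≟ᵥ_ K v ≡ ∑ (colourDegree CL v)
  degree≡∑colourDegree K {CL} lists v =
    trans (degree≡endSum K v) (trans (endSum-↭ (↭-sym lists) v) (endSum≡∑colourDegree CL v))

  Suppressible : MGraph V → V → Set
  Suppressible K v = v ∈ verts K × degree _≟ᵥ_ K v ≡ 2

  -- A colouring that becomes a proper 3-edge-colouring once the degree-2
  -- vertices are suppressed: the two edge-ends at a degree-2 vertex share a
  -- colour, and the edge-ends at any other vertex have distinct colours.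
  ValidAt : MGraph V → (Fin 3 → ℕ) → V → Set
  ValidAt K c v = (Suppressible K v × ∃[ k ] c k ≡ 2) ⊎ (¬ Suppressible K v × ∀ k → c k ≤ 1)

  IsSuppressionColouring : MGraph V → List ColouredEdge → Set
  IsSuppressionColouring K CL = ∀ v → ValidAt K (colourDegree CL v) v

  SuppressionColouring : MGraph V → Set
  SuppressionColouring K = ∃[ CL ] (map proj₁ CL ↭ edges K × IsSuppressionColouring K CL)

  validAt-transfer : ∀ {K K′ c c′ w} → (Suppressible K w ⇔ Suppressible K′ w) → (∀ k → c k ≡ c′ k) →
                     ValidAt K c w → ValidAt K′ c′ w
  validAt-transfer K⇔K′ c≗c′ (inj₁ (s , k , ck≡2)) = inj₁ (Equivalence.to K⇔K′ s , k , trans (sym (c≗c′ k)) ck≡2)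
  validAt-transfer K⇔K′ c≗c′ (inj₂ (¬s , c≤1))     =
    inj₂ (¬s ∘ Equivalence.from K⇔K′ , λ k → subst (_≤ 1) (c≗c′ k) (c≤1 k))

  isSuppressionColouring-↭ : ∀ {K CL CL′} → CL ↭ CL′ → IsSuppressionColouring K CL → IsSuppressionColouring K CL′
  isSuppressionColouring-↭ {K} p sc v = validAt-transfer {K} {K} (mk⇔ id id) (colourDegree-↭ p v) (sc v)

  validAt⇔validCountsᵇ : ∀ {K c w s} → (Suppressible K w ⇔ T s) →
                         ValidAt K c w ⇔ T (validCountsᵇ s (c zero) (c (suc zero)) (c (suc (suc zero))))
  validAt⇔validCountsᵇ {K} {c} {w} {true} sup⇔ = mk⇔ to from
    where
    to : ValidAt K c w → T ((c zero ≡ᵇ 2) ∨ (c (suc zero) ≡ᵇ 2) ∨ (c (suc (suc zero)) ≡ᵇ 2))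
    to (inj₁ (_ , zero , two))           = Equivalence.from (T-∨ {c zero ≡ᵇ 2}) (inj₁ (≡⇒≡ᵇ _ 2 two))
    to (inj₁ (_ , suc zero , two))       =
      Equivalence.from (T-∨ {c zero ≡ᵇ 2}) (inj₂ (Equivalence.from (T-∨ {c (suc zero) ≡ᵇ 2}) (inj₁ (≡⇒≡ᵇ _ 2 two))))
    to (inj₁ (_ , suc (suc zero) , two)) =
      Equivalence.from (T-∨ {c zero ≡ᵇ 2}) (inj₂ (Equivalence.from (T-∨ {c (suc zero) ≡ᵇ 2}) (inj₂ (≡⇒≡ᵇ _ 2 two))))
    to (inj₂ (¬sup , _))                   = ⊥-elim (¬sup (Equivalence.from sup⇔ _))
    from : T ((c zero ≡ᵇ 2) ∨ (c (suc zero) ≡ᵇ 2) ∨ (c (suc (suc zero)) ≡ᵇ 2)) → ValidAt K c w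
    from two with Equivalence.to (T-∨ {c zero ≡ᵇ 2}) two
    ... | inj₁ t₀ = inj₁ (Equivalence.from sup⇔ _ , zero , ≡ᵇ⇒≡ _ 2 t₀)
    ... | inj₂ t₁₂ with Equivalence.to (T-∨ {c (suc zero) ≡ᵇ 2}) t₁₂
    ...   | inj₁ t₁ = inj₁ (Equivalence.from sup⇔ _ , suc zero , ≡ᵇ⇒≡ _ 2 t₁)
    ...   | inj₂ t₂ = inj₁ (Equivalence.from sup⇔ _ , suc (suc zero) , ≡ᵇ⇒≡ _ 2 t₂)
  validAt⇔validCountsᵇ {K} {c} {w} {false} sup⇔ = mk⇔ to from
    where
    to : ValidAt K c w → T ((c zero ≤ᵇ 1) ∧ (c (suc zero) ≤ᵇ 1) ∧ (c (suc (suc zero)) ≤ᵇ 1))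
    to (inj₁ (sup , _))   = ⊥-elim (Equivalence.to sup⇔ sup)
    to (inj₂ (_ , ≤1))    = Equivalence.from (T-∧ {c zero ≤ᵇ 1}) (≤⇒≤ᵇ (≤1 zero) ,
                            Equivalence.from (T-∧ {c (suc zero) ≤ᵇ 1}) (≤⇒≤ᵇ (≤1 (suc zero)) , ≤⇒≤ᵇ (≤1 (suc (suc zero)))))
    from : T ((c zero ≤ᵇ 1) ∧ (c (suc zero) ≤ᵇ 1) ∧ (c (suc (suc zero)) ≤ᵇ 1)) → ValidAt K c w
    from ≤1 = let (≤1₀ , ≤1₁₂) = Equivalence.to (T-∧ {c zero ≤ᵇ 1}) ≤1
                  (≤1₁ , ≤1₂)  = Equivalence.to (T-∧ {c (suc zero) ≤ᵇ 1}) ≤1₁₂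
              in inj₂ (Equivalence.to sup⇔ , λ where
                   zero             → ≤ᵇ⇒≤ _ 1 ≤1₀
                   (suc zero)       → ≤ᵇ⇒≤ _ 1 ≤1₁
                   (suc (suc zero)) → ≤ᵇ⇒≤ _ 1 ≤1₂)

  record VertexRemoval (K K′ : MGraph V) (v : V) (CL CL′ : List ColouredEdge) : Set where
    field
      verts-↭ : verts K ↭ v ∷ verts K′
      lists   : map proj₁ CL ↭ edges K
      lists′  : map proj₁ CL′ ↭ edges K′
      agree   : ∀ {w} → w ≢ v → ∀ k → colourDegree CL w k ≡ colourDegree CL′ w k
      cleared : ∀ k → colourDegree CL′ v k ≡ 0

  module _ {K K′ v CL CL′} (R : VertexRemoval K K′ v CL CL′) where
    open VertexRemoval R

    suppressible-away : ∀ {w} → w ≢ v → Suppressible K w ⇔ Suppressible K′ w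
    suppressible-away {w} w≢v = mk⇔ (λ (w∈ , d) → remaining w∈ , trans (sym degree-agree) d)
                                    (λ (w∈ , d) → ∈-resp-↭ (↭-sym verts-↭) (there w∈) , trans degree-agree d)
      where
      degree-agree : degree _≟ᵥ_ K w ≡ degree _≟ᵥ_ K′ w
      degree-agree = trans (degree≡∑colourDegree K lists w)
                           (trans (sum-cong-≗ (agree w≢v)) (sym (degree≡∑colourDegree K′ lists′ w)))
      remaining : w ∈ verts K → w ∈ verts K′
      remaining w∈ with ∈-resp-↭ verts-↭ w∈
      ... | here w≡v = ⊥-elim (w≢v w≡v)
      ... | there w∈′ = w∈′

    removed-unsuppressible : ¬ Suppressible K′ v
    removed-unsuppressible (_ , d) with () ← trans (sym d) (trans (degree≡∑colourDegree K′ lists′ v) (∑-zero cleared))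

    removal⁺ : IsSuppressionColouring K CL → IsSuppressionColouring K′ CL′
    removal⁺ sc w with w ≟ᵥ v
    ... | yes refl = inj₂ (removed-unsuppressible , λ k → subst (_≤ 1) (sym (cleared k)) z≤n)
    ... | no w≢v   = validAt-transfer {K} {K′} (suppressible-away w≢v) (agree w≢v) (sc w)

    removal⁻ : Suppressible K v → (∃[ k ] colourDegree CL v k ≡ 2) →
               IsSuppressionColouring K′ CL′ → IsSuppressionColouring K CL
    removal⁻ s monochromatic sc w with w ≟ᵥ v
    ... | yes refl = inj₁ (s , monochromatic)
    ... | no w≢v   =
      validAt-transfer {K′} {K} (⇔-sym (suppressible-away w≢v)) (sym ∘ agree w≢v) (sc w)

  if-+-distrib : ∀ b a c r → (if b then a else 0) + ((if b then c else 0) + r) ≡ (if b then a + c else 0) + r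
  if-+-distrib true  a c r = sym (+-assoc a c r)
  if-+-distrib false a c r = refl

  if-zero : ∀ b {a} → a ≡ 0 → (if b then a else 0) ≡ 0
  if-zero true  a≡0 = a≡0
  if-zero false _   = refl

  colourDegree-unused : ∀ R v k → endSum (map proj₁ R) v ≡ 0 → colourDegree R v k ≡ 0
  colourDegree-unused R v k r≡0 = n≤0⇒n≡0 (subst (colourDegree R v k ≤_) r≡0 (colourDegree≤endSum R v k))

  suc-two-ends : ∀ a b c → suc a + (suc b + c) ≡ 2 → a ≡ 0 × b ≡ 0 × c ≡ 0
  suc-two-ends zero    zero    zero    _ = refl , refl , refl
  suc-two-ends zero    zero    (suc c) ()
  suc-two-ends zero    (suc b) c       ()
  suc-two-ends (suc a) b       c       eq with () ← m+n≡0⇒n≡0 a (ℕ-suc-injective (ℕ-suc-injective eq))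

  module SuppressPath (K K′ : MGraph V) {v x y e₁ e₂} {R : List ColouredEdge}
      (deg : degree _≟ᵥ_ K v ≡ 2) (at₁ : EdgeAt v x e₁) (at₂ : EdgeAt v y e₂)
      (es↭ : edges K ↭ e₁ ∷ e₂ ∷ map proj₁ R) (es′↭ : edges K′ ↭ (x , y) ∷ map proj₁ R)
      (vs↭ : verts K ↭ v ∷ verts K′) where

    private
      ends-at-v : suc (𝟙 (same x v)) + (suc (𝟙 (same y v)) + endSum (map proj₁ R) v) ≡ 2
      ends-at-v = begin
        suc (𝟙 (same x v)) + (suc (𝟙 (same y v)) + endSum (map proj₁ R) v)
          ≡⟨ cong₂ (λ a b → a + (b + endSum (map proj₁ R) v)) (endCount-at at₁) (endCount-at at₂) ⟨
        endSum (e₁ ∷ e₂ ∷ map proj₁ R) v                                  ≡⟨ endSum-↭ es↭ v ⟨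
        endSum (edges K) v                                                ≡⟨ degree≡endSum K v ⟨
        degree _≟ᵥ_ K v                                                    ≡⟨ deg ⟩
        2                                                                 ∎
        where open ≡-Reasoning

      vanishing : 𝟙 (same x v) ≡ 0 × 𝟙 (same y v) ≡ 0 × endSum (map proj₁ R) v ≡ 0
      vanishing = suc-two-ends _ _ _ ends-at-v

      x≢v : 𝟙 (same x v) ≡ 0
      x≢v = proj₁ vanishing

      y≢v : 𝟙 (same y v) ≡ 0
      y≢v = proj₁ (proj₂ vanishing)

      rest-avoids-v : endSum (map proj₁ R) v ≡ 0
      rest-avoids-v = proj₂ (proj₂ vanishing)

      e₁-once : ec v e₁ ≡ 1
      e₁-once = trans (endCount-at at₁) (cong suc x≢v)

      e₂-once : ec v e₂ ≡ 1
      e₂-once = trans (endCount-at at₂) (cong suc y≢v)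

      ends-merge : ∀ {w} → w ≢ v → ec w (x , y) ≡ ec w e₁ + ec w e₂
      ends-merge w≢v = sym (cong₂ _+_ (endCount-away w≢v at₁) (endCount-away w≢v at₂))

    removal : ∀ k → VertexRemoval K K′ v ((e₁ , k) ∷ (e₂ , k) ∷ R) (((x , y) , k) ∷ R)
    removal k = record
      { verts-↭ = vs↭
      ; lists   = ↭-sym es↭
      ; lists′  = ↭-sym es′↭
      ; agree   = λ {w} w≢v k′ →
          trans (if-+-distrib (does (k ≟ᶠ k′)) (ec w e₁) (ec w e₂) (colourDegree R w k′))
                (cong (λ n → (if does (k ≟ᶠ k′) then n else 0) + colourDegree R w k′) (sym (ends-merge w≢v)))
      ; cleared = λ k′ → cong₂ _+_ (if-zero (does (k ≟ᶠ k′)) (cong₂ _+_ x≢v y≢v)) (colourDegree-unused R v k′ rest-avoids-v)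
      }

    monochromatic : ∀ k → colourDegree ((e₁ , k) ∷ (e₂ , k) ∷ R) v k ≡ 2
    monochromatic k rewrite dec-true (k ≟ᶠ k) refl =
      trans (cong₂ (λ a b → a + (b + colourDegree R v k)) e₁-once e₂-once) (cong (2 +_) (colourDegree-unused R v k rest-avoids-v))

    monochromatic-only : ∀ {k₁ k₂ k} → colourDegree ((e₁ , k₁) ∷ (e₂ , k₂) ∷ R) v k ≡ 2 → k₁ ≡ k × k₂ ≡ k
    monochromatic-only {k₁} {k₂} {k} two with k₁ ≟ᶠ k | k₂ ≟ᶠ k
    ... | yes k₁≡k | yes k₂≡k = k₁≡k , k₂≡k
    ... | yes _    | no _ with () ← trans (sym two) (cong₂ _+_ e₁-once (colourDegree-unused R v k rest-avoids-v))
    ... | no _     | yes _ with () ← trans (sym two) (cong₂ _+_ e₂-once (colourDegree-unused R v k rest-avoids-v))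
    ... | no _     | no _ with () ← trans (sym two) (colourDegree-unused R v k rest-avoids-v)

  module SuppressLoop (K K′ : MGraph V) {v} {R : List ColouredEdge}
      (deg : degree _≟ᵥ_ K v ≡ 2) (es↭ : edges K ↭ (v , v) ∷ map proj₁ R) (es′↭ : edges K′ ↭ map proj₁ R)
      (vs↭ : verts K ↭ v ∷ verts K′) where

    private
      rest-avoids-v : endSum (map proj₁ R) v ≡ 0
      rest-avoids-v = +-cancelˡ-≡ 2 _ 0 (begin
        2 + endSum (map proj₁ R) v              ≡⟨ cong (_+ endSum (map proj₁ R) v) (endCount-loop {v} {v , v} refl refl) ⟨
        endSum ((v , v) ∷ map proj₁ R) v        ≡⟨ endSum-↭ es↭ v ⟨
        endSum (edges K) v                      ≡⟨ degree≡endSum K v ⟨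
        degree _≟ᵥ_ K v                          ≡⟨ deg ⟩
        2                                       ∎)
        where open ≡-Reasoning

    removal : ∀ k → VertexRemoval K K′ v (((v , v) , k) ∷ R) R
    removal k = record
      { verts-↭ = vs↭
      ; lists   = ↭-sym es↭
      ; lists′  = ↭-sym es′↭
      ; agree   = λ w≢v k′ → cong (_+ colourDegree R _ k′) (if-zero (does (k ≟ᶠ k′)) (endCount-loop-away w≢v))
      ; cleared = λ k′ → colourDegree-unused R v k′ rest-avoids-v
      }

    monochromatic : ∀ k → colourDegree (((v , v) , k) ∷ R) v k ≡ 2
    monochromatic k rewrite dec-true (k ≟ᶠ k) refl =
      cong₂ _+_ (endCount-loop {v} {v , v} refl refl) (colourDegree-unused R v k rest-avoids-v)

  suppressStep⁺ : ∀ {K K′} → SuppressStep _≟ᵥ_ K K′ → SuppressionColouring K → SuppressionColouring K′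
  suppressStep⁺ {K} {K′} (v , v∈ , deg , vs↭ , inj₁ (x , y , e₁ , e₂ , _ , at₁ , at₂ , es↭ , es′↭ , _)) (CL , lists , sc)
    with ↭-map-inv proj₁ (↭-trans lists es↭)
  ... | (_ , k₁) ∷ (_ , k₂) ∷ R , refl , CL↭ with isSuppressionColouring-↭ {K} CL↭ sc
  ... | sc′ with sc′ v
  ... | inj₂ (¬s , _) = ⊥-elim (¬s (v∈ , deg))
  ... | inj₁ (_ , k , two) with SuppressPath.monochromatic-only K K′ deg at₁ at₂ es↭ es′↭ vs↭ {k₁} {k₂} {k} two
  ... | refl , refl = ((x , y) , k) ∷ R , ↭-sym es′↭ , removal⁺ (SuppressPath.removal K K′ deg at₁ at₂ es↭ es′↭ vs↭ k) sc′
  suppressStep⁺ {K} {K′} (v , v∈ , deg , vs↭ , inj₂ (_ , es↭ , es′↭ , _)) (CL , lists , sc)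
    with ↭-map-inv proj₁ (↭-trans lists es↭)
  ... | (_ , k) ∷ R , refl , CL↭ =
    R , ↭-sym es′↭ , removal⁺ (SuppressLoop.removal K K′ deg es↭ es′↭ vs↭ k) (isSuppressionColouring-↭ {K} CL↭ sc)

  suppressStep⁻ : ∀ {K K′} → SuppressStep _≟ᵥ_ K K′ → SuppressionColouring K′ → SuppressionColouring K
  suppressStep⁻ {K} {K′} (v , v∈ , deg , vs↭ , inj₁ (x , y , e₁ , e₂ , _ , at₁ , at₂ , es↭ , es′↭ , _)) (CL , lists , sc)
    with ↭-map-inv proj₁ (↭-trans lists es′↭)
  ... | (_ , k) ∷ R , refl , CL↭ =
    (e₁ , k) ∷ (e₂ , k) ∷ R , ↭-sym es↭ ,
    removal⁻ (removal k) (v∈ , deg) (k , monochromatic k) (isSuppressionColouring-↭ {K′} CL↭ sc)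
    where open SuppressPath K K′ deg at₁ at₂ es↭ es′↭ vs↭
  suppressStep⁻ {K} {K′} (v , v∈ , deg , vs↭ , inj₂ (_ , es↭ , es′↭ , _)) (CL , lists , sc)
    with ↭-map-inv proj₁ (↭-trans lists es′↭)
  ... | R , refl , CL↭ =
    ((v , v) , zero) ∷ R , ↭-sym es↭ ,
    removal⁻ (removal zero) (v∈ , deg) (zero , monochromatic zero) (isSuppressionColouring-↭ {K′} CL↭ sc)
    where open SuppressLoop K K′ deg es↭ es′↭ vs↭

  suppression⁺ : ∀ {K H} → Star (SuppressStep _≟ᵥ_) K H → SuppressionColouring K → SuppressionColouring H
  suppression⁺ ε        = id
  suppression⁺ (s ◅ ss) = suppression⁺ ss ∘ suppressStep⁺ s

  suppression⁻ : ∀ {K H} → Star (SuppressStep _≟ᵥ_) K H → SuppressionColouring H → SuppressionColouring K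
  suppression⁻ ε        = id
  suppression⁻ (s ◅ ss) = suppressStep⁻ s ∘ suppression⁻ ss

  private
    move-front : ∀ {A : Set} (p e₁ e₂ : A) rest → p ∷ e₁ ∷ e₂ ∷ rest ↭ e₁ ∷ e₂ ∷ p ∷ rest
    move-front p e₁ e₂ rest = ↭-trans (swap p e₁ ↭-refl) (prep e₁ (swap p e₂ ↭-refl))

  oneEnd : ∀ es v → endSum es v ≡ 1 → ∃[ y ] ∃[ e ] ∃[ rest ] (EdgeAt v y e × es ↭ e ∷ rest)
  oneEnd []             v ()
  oneEnd ((x , y) ∷ es) v one with x ≟ᵥ v | y ≟ᵥ v
  ... | yes refl | yes refl with () ← one
  ... | yes refl | no _     = y , (x , y) , es , inj₁ refl , ↭-refl
  ... | no _     | yes refl = x , (x , y) , es , inj₂ refl , ↭-refl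
  ... | no _     | no _     with oneEnd es v one
  ... | y′ , e , rest , at , es↭ = y′ , e , (x , y) ∷ rest , at , ↭-trans (prep _ es↭) (swap _ _ ↭-refl)

  twoEnds : ∀ es v → endSum es v ≡ 2 →
            (∃[ x ] ∃[ y ] ∃[ e₁ ] ∃[ e₂ ] ∃[ rest ] (EdgeAt v x e₁ × EdgeAt v y e₂ × es ↭ e₁ ∷ e₂ ∷ rest))
            ⊎ (∃[ rest ] (es ↭ (v , v) ∷ rest))
  twoEnds []             v ()
  twoEnds ((x , y) ∷ es) v two with x ≟ᵥ v | y ≟ᵥ v
  ... | yes refl | yes refl = inj₂ (es , ↭-refl)
  ... | yes refl | no _     with oneEnd es v (ℕ-suc-injective two)
  ...   | y′ , e₂ , rest , at₂ , es↭ = inj₁ (y , y′ , (x , y) , e₂ , rest , inj₁ refl , at₂ , prep _ es↭)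
  twoEnds ((x , y) ∷ es) v two | no _ | yes refl with oneEnd es v (ℕ-suc-injective two)
  ...   | y′ , e₂ , rest , at₂ , es↭ = inj₁ (x , y′ , (x , y) , e₂ , rest , inj₂ refl , at₂ , prep _ es↭)
  twoEnds ((x , y) ∷ es) v two | no _ | no _ with twoEnds es v two
  ... | inj₁ (x′ , y′ , e₁ , e₂ , rest , at₁ , at₂ , es↭) =
          inj₁ (x′ , y′ , e₁ , e₂ , (x , y) ∷ rest , at₁ , at₂ , ↭-trans (prep _ es↭) (move-front _ _ _ _))
  ... | inj₂ (rest , es↭) = inj₂ ((x , y) ∷ rest , ↭-trans (prep _ es↭) (swap _ _ ↭-refl))

  suppressStep-exists : ∀ K v → v ∈ verts K → degree _≟ᵥ_ K v ≡ 2 →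
                        ∃[ K′ ] (SuppressStep _≟ᵥ_ K K′ × suc (length (verts K′)) ≡ length (verts K))
  suppressStep-exists K v v∈ deg with ∈-∃++ v∈
  ... | pre , post , vs≡ with twoEnds (edges K) v (trans (sym (degree≡endSum K v)) deg)
  ... | inj₁ (x , y , e₁ , e₂ , rest , at₁ , at₂ , es↭) =
        mkGraph (pre ++ post) ((x , y) ∷ rest) (loops K) ,
        (v , v∈ , deg , vs↭ , inj₁ (x , y , e₁ , e₂ , rest , at₁ , at₂ , es↭ , ↭-refl , refl)) ,
        sym (↭-length vs↭)
    where vs↭ = subst (_↭ v ∷ pre ++ post) (sym vs≡) (shift v pre post)
  ... | inj₂ (rest , es↭) =
        mkGraph (pre ++ post) rest (suc (loops K)) ,
        (v , v∈ , deg , vs↭ , inj₂ (rest , es↭ , ↭-refl , refl)) ,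
        sym (↭-length vs↭)
    where vs↭ = subst (_↭ v ∷ pre ++ post) (sym vs≡) (shift v pre post)

  suppression-exists : ∀ K → ∃[ H ] SuppressionOf _≟ᵥ_ K H
  suppression-exists K = go _ K refl
    where
    go : ∀ n J → length (verts J) ≡ n → ∃[ H ] SuppressionOf _≟ᵥ_ J H
    go n J len with any? (λ v → degree _≟ᵥ_ J v ≟ 2) (verts J)
    ... | no none = J , ε , λ v v∈ deg → none (lose v∈ deg)
    ... | yes some with find some
    ... | v , v∈ , deg with suppressStep-exists J v v∈ deg
    go zero    J len | yes _ | _ | J′ , step , shorter with () ← trans shorter len
    go (suc n) J len | yes _ | _ | J′ , step , shorter with go n J′ (ℕ-suc-injective (trans shorter len))
    ... | H , steps , final = H , step ◅ steps , final

  NoSuppressible : MGraph V → Set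
  NoSuppressible H = ∀ v → v ∈ verts H → ¬ (degree _≟ᵥ_ H v ≡ 2)

  private
    if-≤ : ∀ b {a} → (if b then a else 0) ≤ a
    if-≤ true  = ≤-reflexive refl
    if-≤ false = z≤n

    if-positive : ∀ b {a} → 0 < (if b then a else 0) → b ≡ true × 0 < a
    if-positive true pos = refl , pos

  colourable⇒suppressionColouring : ∀ H → NoSuppressible H → ThreeEdgeColourable H → SuppressionColouring H
  colourable⇒suppressionColouring H none (c , loopless , proper) =
    CL , ↭-reflexive lists , λ v → inj₂ ((λ (v∈ , deg) → none v v∈ deg) , at-most-one v)
    where
    es = edges H
    CL : List ColouredEdge
    CL = map (λ i → lookup es i , c i) (allFin _)
    atColour : V → Fin 3 → Edge H → ℕ
    atColour v k i = if does (c i ≟ᶠ k) then ec v (lookup es i) else 0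
    lists : map proj₁ CL ≡ es
    lists = trans (sym (map-∘ (allFin _))) (trans (map-tabulate id (lookup es)) (tabulate-lookup es))
    degree-as-∑ : ∀ v k → colourDegree CL v k ≡ ∑ (atColour v k)
    degree-as-∑ v k =
      trans (cong sum (sym (map-∘ {g = λ ce → if does (proj₂ ce ≟ᶠ k) then ec v (proj₁ ce) else 0} (allFin (length es)))))
            (∑-allFin (atColour v k))
    does-true : ∀ {a b : Fin 3} → does (a ≟ᶠ b) ≡ true → a ≡ b
    does-true {a} {b} eq with a ≟ᶠ b
    ... | yes a≡b = a≡b
    at-most-one : ∀ v k → colourDegree CL v k ≤ 1
    at-most-one v k = subst (_≤ 1) (sym (degree-as-∑ v k)) (∑≤1 (atColour v k)
      (λ i → ≤-trans (if-≤ (does (c i ≟ᶠ k))) (endCount-nonLoop v _ (loopless i)))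
      λ {i} {j} i≢j pos-i pos-j →
        let (ci≡k , at-i) = if-positive (does (c i ≟ᶠ k)) pos-i
            (cj≡k , at-j) = if-positive (does (c j ≟ᶠ k)) pos-j
        in proper i j i≢j (v , endCount-positive v _ at-i , endCount-positive v _ at-j)
                  (trans (does-true ci≡k) (sym (does-true cj≡k))))

  private
    colourOf : (Z : List ColouredEdge) → Fin (length (map proj₁ Z)) → Fin 3
    colourOf (ce ∷ Z) zero    = proj₂ ce
    colourOf (ce ∷ Z) (suc i) = colourOf Z i

    contributionOf : (Z : List ColouredEdge) → V → Fin 3 → Fin (length (map proj₁ Z)) → ℕ
    contributionOf Z v k i = if does (colourOf Z i ≟ᶠ k) then ec v (lookup (map proj₁ Z) i) else 0

    colourDegree-as-∑ : ∀ Z v k → colourDegree Z v k ≡ ∑ (contributionOf Z v k)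
    colourDegree-as-∑ []       v k = refl
    colourDegree-as-∑ (ce ∷ Z) v k = cong (_ +_) (colourDegree-as-∑ Z v k)

    2≰1 : ¬ (2 ≤ 1)
    2≰1 (s≤s ())

  listColouring : ∀ Z vs l → (∀ v k → colourDegree Z v k ≤ 1) → ThreeEdgeColourable (mkGraph vs (map proj₁ Z) l)
  listColouring Z vs l ≤1 = colourOf Z , loopless , proper
    where
    bound : ∀ v k → ∑ (contributionOf Z v k) ≤ 1
    bound v k = subst (_≤ 1) (colourDegree-as-∑ Z v k) (≤1 v k)
    own-colour : ∀ v i → contributionOf Z v (colourOf Z i) i ≡ ec v (lookup (map proj₁ Z) i)
    own-colour v i rewrite dec-true (colourOf Z i ≟ᶠ colourOf Z i) refl = refl
    loopless : ∀ e → proj₁ (lookup (map proj₁ Z) e) ≢ proj₂ (lookup (map proj₁ Z) e)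
    loopless e loop = 2≰1 (begin
      2                                   ≡⟨ endCount-loop refl (sym loop) ⟨
      ec v (lookup (map proj₁ Z) e)        ≡⟨ own-colour v e ⟨
      contributionOf Z v (colourOf Z e) e ≤⟨ term≤∑ (contributionOf Z v (colourOf Z e)) e ⟩
      ∑ (contributionOf Z v (colourOf Z e)) ≤⟨ bound v (colourOf Z e) ⟩
      1                                   ∎)
      where
      open ≤-Reasoning
      v = proj₁ (lookup (map proj₁ Z) e)
    proper : ∀ e f → e ≢ f → Adjacent (mkGraph vs (map proj₁ Z) l) e f → colourOf Z e ≢ colourOf Z f
    proper e f e≢f (v , inc-e , inc-f) same = 2≰1 (begin
      1 + 1                                                         ≤⟨ +-mono-≤ at-e at-f ⟩
      contributionOf Z v k e + contributionOf Z v k f               ≤⟨ pair≤∑ (contributionOf Z v k) e≢f ⟩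
      ∑ (contributionOf Z v k)                                      ≤⟨ bound v k ⟩
      1                                                             ∎)
      where
      open ≤-Reasoning
      k = colourOf Z e
      at-e : 0 < contributionOf Z v k e
      at-e = subst (0 <_) (sym (own-colour v e)) (endCount-incident v _ inc-e)
      at-f : 0 < contributionOf Z v k f
      at-f = subst (λ k′ → 0 < contributionOf Z v k′ f) (sym same) (subst (0 <_) (sym (own-colour v f)) (endCount-incident v _ inc-f))

  suppressionColouring⇒colourable : ∀ H → NoSuppressible H → SuppressionColouring H → ThreeEdgeColourable H
  suppressionColouring⇒colourable H none (CL , lists , sc) with ↭-map-inv proj₁ lists
  ... | Z , es≡ , CL↭Z =
    subst (λ es → ThreeEdgeColourable (mkGraph (verts H) es (loops H))) (sym es≡) (listColouring Z (verts H) (loops H) bound)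
    where
    bound : ∀ v k → colourDegree Z v k ≤ 1
    bound v k with isSuppressionColouring-↭ {H} CL↭Z sc v
    ... | inj₁ ((v∈ , deg) , _) = ⊥-elim (none v v∈ deg)
    ... | inj₂ (_ , ≤1)         = ≤1 k

  suppressedColourable⇔suppressionColouring : ∀ K → SuppressedThreeEdgeColourable _≟ᵥ_ K ⇔ SuppressionColouring K
  suppressedColourable⇔suppressionColouring K = mk⇔
    (λ (H , (steps , final) , col) → suppression⁻ steps (colourable⇒suppressionColouring H final col))
    (λ sc → let (H , steps , final) = suppression-exists K
            in H , (steps , final) , suppressionColouring⇒colourable H final (suppression⁺ steps sc))

-- Bridgeless cubic graphs

module CubicBridgeless (G : MGraph ℕ) (wf : WellFormed G) (cubic : Cubic _≟_ G) (bridgeless : Bridgeless G) where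

  open Suppression _≟_ using (ec; endCount-loop; endCount-positive; endCount-incident; endCount-nonLoop)

  incidence : ℕ → Edge G → ℕ
  incidence a e = ec a (ends G e)

  degreeIn≡∑ : ∀ S a → degreeIn _≟_ G S a ≡ ∑ (λ e → if S e then incidence a e else 0)
  degreeIn≡∑ S a = ∑-allFin (λ e → if S e then incidence a e else 0)

  ∑incidence≡3 : ∀ {a} → a ∈ verts G → ∑ (incidence a) ≡ 3
  ∑incidence≡3 {a} a∈ = trans (sym (degreeIn≡∑ _ a)) (cubic a a∈)

  module _ {v} (e f : Edge G) (e₁≡v : proj₁ (ends G e) ≡ v) (e₂≡v : proj₂ (ends G e) ≡ v)
           (f-once : incidence v f ≡ 1) (only-f : ∀ g → g ≢ e → 0 < incidence v g → g ≡ f) where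

    private
      -- avoiding f, the only edge at v is the loop e, so no path leaves v
      stays : ∀ {x z} → StepAvoiding G f x z → x ≡ v ⊎ z ≡ v → x ≡ v × z ≡ v
      stays (g , g≢f , g-ends) touches with g ≟ᶠ e
      ... | yes refl = ends-of-e g-ends
        where
        ends-of-e : ∀ {x z} → ends G e ≡ (x , z) ⊎ ends G e ≡ (z , x) → x ≡ v × z ≡ v
        ends-of-e (inj₁ eq) = trans (sym (cong proj₁ eq)) e₁≡v , trans (sym (cong proj₂ eq)) e₂≡v
        ends-of-e (inj₂ eq) = trans (sym (cong proj₂ eq)) e₂≡v , trans (sym (cong proj₁ eq)) e₁≡v
      ... | no g≢e = ⊥-elim (g≢f (only-f g g≢e (endCount-incident v (ends G g) (incident g-ends touches))))
        where
        incident : ∀ {x z} → ends G g ≡ (x , z) ⊎ ends G g ≡ (z , x) → x ≡ v ⊎ z ≡ v →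
                   proj₁ (ends G g) ≡ v ⊎ proj₂ (ends G g) ≡ v
        incident (inj₁ eq) (inj₁ x≡v) = inj₁ (trans (cong proj₁ eq) x≡v)
        incident (inj₁ eq) (inj₂ z≡v) = inj₂ (trans (cong proj₂ eq) z≡v)
        incident (inj₂ eq) (inj₁ x≡v) = inj₂ (trans (cong proj₂ eq) x≡v)
        incident (inj₂ eq) (inj₂ z≡v) = inj₁ (trans (cong proj₁ eq) z≡v)

      stays⁺ : ∀ {x y} → Star (StepAvoiding G f) x y → x ≡ v → y ≡ v
      stays⁺ ε        x≡v = x≡v
      stays⁺ (s ◅ ss) x≡v = stays⁺ ss (proj₂ (stays s (inj₁ x≡v)))

      stays⁻ : ∀ {x y} → Star (StepAvoiding G f) x y → y ≡ v → x ≡ v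
      stays⁻ ε        y≡v = y≡v
      stays⁻ (s ◅ ss) y≡v = proj₁ (stays s (inj₂ (stays⁻ ss y≡v)))

      f-not-loop : proj₁ (ends G f) ≡ v → proj₂ (ends G f) ≡ v → ⊥
      f-not-loop p q with () ← trans (sym f-once) (endCount-loop p q)

    pendant-bridge : IsBridge G f
    pendant-bridge path with endCount-positive v (ends G f) (subst (0 <_) (sym f-once) (s≤s z≤n))
    ... | inj₁ p = f-not-loop p (stays⁺ path p)
    ... | inj₂ q = f-not-loop (stays⁻ path q) q

  loopless : ∀ e → proj₁ (ends G e) ≢ proj₂ (ends G e)
  loopless e loop = bridge (support-one {f = incidence v except e} bounded others-once)
    where
    v = proj₁ (ends G e)

    others-once : ∑ (incidence v except e) ≡ 1
    others-once = +-cancelˡ-≡ 2 _ 1 (trans (cong (_+ ∑ (incidence v except e)) (sym (endCount-loop refl (sym loop))))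
                                           (trans (sym (∑-except (incidence v) e)) (∑incidence≡3 (proj₁ (proj₂ wf e)))))

    bounded : ∀ i → (incidence v except e) i ≤ 1
    bounded i = subst ((incidence v except e) i ≤_) others-once (term≤∑ _ i)

    bridge : ∃[ f ] ((incidence v except e) f ≡ 1 × (∀ {g} → 0 < (incidence v except e) g → g ≡ f)) → ⊥
    bridge (f , f-once , only) = bridgeless f (pendant-bridge e f refl (sym loop) f-once′ only-f)
      where
      f≢e : f ≢ e
      f≢e refl with () ← trans (sym f-once) (except-self (incidence v) e)
      f-once′ : incidence v f ≡ 1
      f-once′ = trans (sym (except-≢ (incidence v) f≢e)) f-once
      only-f : ∀ g → g ≢ e → 0 < incidence v g → g ≡ f
      only-f g g≢e pos = only (subst (0 <_) (sym (except-≢ (incidence v) g≢e)) pos)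

  incidence≤1 : ∀ a e → incidence a e ≤ 1
  incidence≤1 a e = endCount-nonLoop a (ends G e) (loopless e)

  threeEdges : ∀ {a} → a ∈ verts G → Support₃ (incidence a)
  threeEdges {a} a∈ = support-three {f = incidence a} (incidence≤1 a) (∑incidence≡3 a∈)

  incidence-outside : ∀ {a} → ¬ (a ∈ verts G) → ∀ e → incidence a e ≡ 0
  incidence-outside {a} a∉ e = n≤0⇒n≡0 (≮⇒≥ (λ pos → a∉ (end∈ (endCount-positive a (ends G e) pos))))
    where
    end∈ : proj₁ (ends G e) ≡ a ⊎ proj₂ (ends G e) ≡ a → a ∈ verts G
    end∈ (inj₁ x≡a) = subst (_∈ verts G) x≡a (proj₁ (proj₂ wf e))
    end∈ (inj₂ y≡a) = subst (_∈ verts G) y≡a (proj₂ (proj₂ wf e))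

-- The configuration at a vertex

record Enumeration (A : Set) : Set where
  field
    elements : List A
    complete : ∀ a → a ∈ elements
open Enumeration

byEnumeration : ∀ {A} (E : Enumeration A) (p : A → Bool) → T (all p (elements E)) → ∀ a → T (p a)
byEnumeration E p ok a = All.lookup (all⁺ p (elements E) ok) (complete E a)

booleans : Enumeration Bool
booleans = record { elements = true ∷ false ∷ [] ; complete = λ { true → here refl ; false → there (here refl) } }

colours : Enumeration (Fin 3)
colours = record { elements = allFin 3 ; complete = ∈-allFin }

_⊗_ : ∀ {A B} → Enumeration A → Enumeration B → Enumeration (A × B)
E ⊗ F = record { elements = cartesianProduct (elements E) (elements F)
               ; complete = λ (a , b) → ∈-cartesianProduct⁺ (complete E a) (complete F b) }
infixr 4 _⊗_

implied : ∀ {h c} → T (not h ∨ c) → T h → T c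
implied {true} c _ = c

sameTag : Tag → Tag → Bool
sameTag s t = isYes (s ≟Tag t)

sameColour : Fin 3 → Fin 3 → Bool
sameColour c k = does (c ≟ᶠ k)

tagPresent : (covered : Bool) → Tag → Bool
tagPresent true  ′ = true
tagPresent true  ″ = true
tagPresent false o = true
tagPresent _     _ = false

copyTag : (inB covered : Bool) → Tag
copyTag inB covered = if covered then (if inB then ″ else ′) else o

-- an edge e at one of its ends a, as seen in G_{A_i}: membership in A_i and
-- A_j, and the colours α of (the first copy of) e and β of its second copy
record EdgeView : Set where
  constructor view
  field
    inA inB : Bool
    α β     : Fin 3
open EdgeView using (inA; inB)

dropβ : EdgeView → EdgeView
dropβ (view p q α _) = view p q α zero

contribution : EdgeView → (covered : Bool) → Tag → Fin 3 → ℕ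
contribution (view true  _   α β) _       t k =
  (if sameColour α k then 𝟙 (sameTag ′ t) else 0) + (if sameColour β k then 𝟙 (sameTag ″ t) else 0)
contribution (view false inB α _) covered t k = if sameColour α k then 𝟙 (sameTag (copyTag inB covered) t) else 0

trues : Bool → Bool → Bool → ℕ
trues a b c = 𝟙 a + (𝟙 b + 𝟙 c)

-- the copies (a , t) of a vertex a of G whose three edges are seen as v₁ , v₂ , v₃
module Local (v₁ v₂ v₃ : EdgeView) where

  coveredᵇ : Bool
  coveredᵇ = isYes (1 ≤? trues (inA v₁) (inA v₂) (inA v₃))

  count : Tag → Fin 3 → ℕ
  count t k = contribution v₁ coveredᵇ t k + (contribution v₂ coveredᵇ t k + contribution v₃ coveredᵇ t k)

  suppressibleᵇ : Tag → Bool
  suppressibleᵇ t = tagPresent coveredᵇ t ∧ (∑ (count t) ≡ᵇ 2)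

  validᵇ : Tag → Bool
  validᵇ t = validCountsᵇ (suppressibleᵇ t) (count t zero) (count t (suc zero)) (count t (suc (suc zero)))

  cycleUnionᵇ : Bool
  cycleUnionᵇ = (trues (inA v₁) (inA v₂) (inA v₃) ≤ᵇ 1) ∧ (trues (inB v₁) (inB v₂) (inB v₃) ≤ᵇ 1)
              ∧ ((union ≡ᵇ 0) ∨ (union ≡ᵇ 2))
    where union = trues (inA v₁ ∨ inB v₁) (inA v₂ ∨ inB v₂) (inA v₃ ∨ inB v₃)

if-constant : ∀ b (n : ℕ) → (if b then n else n) ≡ n
if-constant true  n = refl
if-constant false n = refl

-- the second copy of an A_i-edge only meets copies tagged ″
contribution-β-irrelevant : ∀ v covered t k → t ≢ ″ → contribution v covered t k ≡ contribution (dropβ v) covered t k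
contribution-β-irrelevant (view true _ α β) _ o k _ =
  cong ((if sameColour α k then 0 else 0) +_) (trans (if-constant (sameColour β k) 0) (sym (if-constant (sameColour zero k) 0)))
contribution-β-irrelevant (view true _ α β) _ ′ k _ =
  cong ((if sameColour α k then 1 else 0) +_) (trans (if-constant (sameColour β k) 0) (sym (if-constant (sameColour zero k) 0)))
contribution-β-irrelevant (view true  _ _ _) _ ″ _ t≢″ = ⊥-elim (t≢″ refl)
contribution-β-irrelevant (view false _ _ _) _ _ _ _   = refl

validᵇ-β-irrelevant : ∀ v₁ v₂ v₃ t → t ≢ ″ → Local.validᵇ v₁ v₂ v₃ t ≡ Local.validᵇ (dropβ v₁) (dropβ v₂) (dropβ v₃) t
validᵇ-β-irrelevant v₁ v₂ v₃ t t≢″ =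
  cong₂ (λ c₀ c₁₂ → validFromCounts c₀ (proj₁ c₁₂) (proj₂ c₁₂))
        (same-count zero) (cong₂ _,_ (same-count (suc zero)) (same-count (suc (suc zero))))
  where
  open Local v₁ v₂ v₃
  module D = Local (dropβ v₁) (dropβ v₂) (dropβ v₃)
  validFromCounts : ℕ → ℕ → ℕ → Bool
  validFromCounts c₀ c₁ c₂ = validCountsᵇ (tagPresent coveredᵇ t ∧ (c₀ + (c₁ + (c₂ + 0)) ≡ᵇ 2)) c₀ c₁ c₂
  same-count : ∀ k → count t k ≡ D.count t k
  same-count k = cong₂ _+_ (contribution-β-irrelevant v₁ coveredᵇ t k t≢″)
                   (cong₂ _+_ (contribution-β-irrelevant v₂ coveredᵇ t k t≢″) (contribution-β-irrelevant v₃ coveredᵇ t k t≢″))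

inMatching : EdgeView → Fin 3 → Bool
inMatching (view true  _     α _) k = not (sameColour α k)
inMatching (view false true  _ _) k = false
inMatching (view false false α _) k = sameColour α k

perfectAtᵇ : EdgeView → EdgeView → EdgeView → Bool
perfectAtᵇ v₁ v₂ v₃ = all (λ k → trues (inMatching v₁ k) (inMatching v₂ k) (inMatching v₃ k) ≡ᵇ 1) (allFin 3)

inMatching-notAll : ∀ v → inMatching v zero ∧ inMatching v (suc zero) ∧ inMatching v (suc (suc zero)) ≡ false
inMatching-notAll (view true  _     zero             _) = refl
inMatching-notAll (view true  _     (suc zero)       _) = refl
inMatching-notAll (view true  _     (suc (suc zero)) _) = refl
inMatching-notAll (view false true  _                _) = refl
inMatching-notAll (view false false zero             _) = refl
inMatching-notAll (view false false (suc zero)       _) = refl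
inMatching-notAll (view false false (suc (suc zero)) _) = refl

matchings-local : ∀ v₁ v₂ v₃ → let open Local (dropβ v₁) (dropβ v₂) (dropβ v₃) in
  T cycleUnionᵇ → T (validᵇ o) → T (validᵇ ′) → T (perfectAtᵇ (dropβ v₁) (dropβ v₂) (dropβ v₃))
matchings-local (view p₁ q₁ α₁ _) (view p₂ q₂ α₂ _) (view p₃ q₃ α₃ _) cycles valid-o valid-′ =
  implied (byEnumeration (E ⊗ E ⊗ E) check _ ((p₁ , q₁ , α₁) , (p₂ , q₂ , α₂) , (p₃ , q₃ , α₃)))
          (Equivalence.from T-∧ (cycles , Equivalence.from T-∧ (valid-o , valid-′)))
  where
  E = booleans ⊗ booleans ⊗ colours
  check : (Bool × Bool × Fin 3) × (Bool × Bool × Fin 3) × (Bool × Bool × Fin 3) → Bool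
  check ((p₁ , q₁ , α₁) , (p₂ , q₂ , α₂) , (p₃ , q₃ , α₃)) =
    let v₁ = view p₁ q₁ α₁ zero ; v₂ = view p₂ q₂ α₂ zero ; v₃ = view p₃ q₃ α₃ zero ; open Local v₁ v₂ v₃ in
    not (cycleUnionᵇ ∧ (validᵇ o ∧ validᵇ ′)) ∨ perfectAtᵇ v₁ v₂ v₃

-- An edge with memberships x , y , z in M₁ , M₂ , M₃: A₁ consists of the edges
-- in two of the matchings, A₂ of those in none; an edge of A₁ is coloured by
-- the matching missing it, an edge in exactly one matching by that matching,
-- and the edges of A₂ get the colour of the second copies of A₁-edges.
twoOf noneOf : Bool → Bool → Bool → Bool
twoOf  x y z = (x ∧ y) ∨ (x ∧ z) ∨ (y ∧ z)
noneOf x y z = not (x ∨ y ∨ z)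

frColour : Bool → Bool → Bool → Fin 3
frColour true  true  _     = suc (suc zero)
frColour true  false true  = suc zero
frColour false true  true  = zero
frColour true  false false = zero
frColour false true  false = suc zero
frColour false false true  = suc (suc zero)
frColour false false false = zero

frView : Bool → Bool → Bool → EdgeView
frView x y z = view (twoOf x y z) (noneOf x y z) (frColour x y z) zero

twoOf-noneOf-disjoint : ∀ x y z → twoOf x y z ∧ noneOf x y z ≡ false
twoOf-noneOf-disjoint true  true  _     = refl
twoOf-noneOf-disjoint true  false true  = refl
twoOf-noneOf-disjoint true  false false = refl
twoOf-noneOf-disjoint false true  true  = refl
twoOf-noneOf-disjoint false true  false = refl
twoOf-noneOf-disjoint false false _     = refl

frTripleAtᵇ : (x₁ y₁ z₁ x₂ y₂ z₂ x₃ y₃ z₃ : Bool) → Bool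
frTripleAtᵇ x₁ y₁ z₁ x₂ y₂ z₂ x₃ y₃ z₃ =
  (trues x₁ x₂ x₃ ≡ᵇ 1) ∧ (trues y₁ y₂ y₃ ≡ᵇ 1) ∧ (trues z₁ z₂ z₃ ≡ᵇ 1)
  ∧ not (x₁ ∧ y₁ ∧ z₁) ∧ not (x₂ ∧ y₂ ∧ z₂) ∧ not (x₃ ∧ y₃ ∧ z₃)

splitting-local : ∀ x₁ y₁ z₁ x₂ y₂ z₂ x₃ y₃ z₃ →
  let open Local (frView x₁ y₁ z₁) (frView x₂ y₂ z₂) (frView x₃ y₃ z₃) in
  T (frTripleAtᵇ x₁ y₁ z₁ x₂ y₂ z₂ x₃ y₃ z₃) → T (cycleUnionᵇ ∧ (validᵇ o ∧ (validᵇ ′ ∧ validᵇ ″)))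
splitting-local x₁ y₁ z₁ x₂ y₂ z₂ x₃ y₃ z₃ =
  implied (byEnumeration (E ⊗ E ⊗ E) check _ ((x₁ , y₁ , z₁) , (x₂ , y₂ , z₂) , (x₃ , y₃ , z₃)))
  where
  E = booleans ⊗ booleans ⊗ booleans
  check : (Bool × Bool × Bool) × (Bool × Bool × Bool) × (Bool × Bool × Bool) → Bool
  check ((x₁ , y₁ , z₁) , (x₂ , y₂ , z₂) , (x₃ , y₃ , z₃)) =
    let open Local (frView x₁ y₁ z₁) (frView x₂ y₂ z₂) (frView x₃ y₃ z₃) in
    not (frTripleAtᵇ x₁ y₁ z₁ x₂ y₂ z₂ x₃ y₃ z₃) ∨ (cycleUnionᵇ ∧ (validᵇ o ∧ (validᵇ ′ ∧ validᵇ ″)))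

-- The split graph G_{A_i}

module Splitting (G : MGraph ℕ) (Ai Aj : EdgeSet G) where

  open Suppression _≟S_
  module N = Suppression _≟_

  K : MGraph (ℕ × Tag)
  K = split G Ai Aj

  covered : ℕ → Bool
  covered a = isYes (1 ≤? degreeIn _≟_ G Ai a)

  label : Bool → ℕ → ℕ × Tag
  label inB x = if covered x then (if inB then (x , ″) else (x , ′)) else (x , o)

  -- the copies of an edge xy in G_{A_i}: these definitions unfold to those in
  -- split, so that edges K is definitionally concatMap copies (allFin _)
  copiesOf : (inA inB : Bool) → ℕ → ℕ → List ((ℕ × Tag) × (ℕ × Tag))
  copiesOf inA inB x y =
    if inA then ((x , ′) , (y , ′)) ∷ ((x , ″) , (y , ″)) ∷ [] else (label inB x , label inB y) ∷ []

  copies : Edge G → List ((ℕ × Tag) × (ℕ × Tag))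
  copies e = copiesOf (Ai e) (Aj e) (proj₁ (ends G e)) (proj₂ (ends G e))

  label≡copyTag : ∀ inB x → label inB x ≡ (x , copyTag inB (covered x))
  label≡copyTag inB x with covered x | inB
  ... | true  | true  = refl
  ... | true  | false = refl
  ... | false | _     = refl

  same-copy : ∀ x s a t → isYes ((x , s) ≟S (a , t)) ≡ N.same x a ∧ sameTag s t
  same-copy x s a t = compare ((x , s) ≟S (a , t)) (x ≟ a) (s ≟Tag t)
    where
    compare : ∀ d (dx : Dec (x ≡ a)) (ds : Dec (s ≡ t)) → isYes d ≡ isYes dx ∧ isYes ds
    compare (yes eq) (yes _)   (yes _)   = refl
    compare (yes eq) (no x≢a)  _         = ⊥-elim (x≢a (cong proj₁ eq))
    compare (yes eq) (yes _)   (no s≢t)  = ⊥-elim (s≢t (cong proj₂ eq))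
    compare (no neq) (yes refl) (yes refl) = ⊥-elim (neq refl)
    compare (no _)   (no _)    _         = refl
    compare (no _)   (yes _)   (no _)    = refl

  endCount-copy : ∀ a t x y s s′ →
                  ec (a , t) ((x , s) , (y , s′)) ≡ 𝟙 (N.same x a ∧ sameTag s t) + 𝟙 (N.same y a ∧ sameTag s′ t)
  endCount-copy a t x y s s′ = cong₂ (λ b b′ → 𝟙 b + 𝟙 b′) (same-copy x s a t) (same-copy y s′ a t)

  -- zip drops β for an edge outside A_i, which has a single copy
  colourCopies : (inA inB : Bool) → ℕ → ℕ → Fin 3 → Fin 3 → List ColouredEdge
  colourCopies inA inB x y α β = zip (copiesOf inA inB x y) (α ∷ β ∷ [])

  colourCopies-away : ∀ p q {x y a} α β t k → N.same x a ≡ false → N.same y a ≡ false →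
                       colourDegree (colourCopies p q x y α β) (a , t) k ≡ 0
  colourCopies-away true q {x} {y} {a} α β t k x≢a y≢a
    rewrite endCount-copy a t x y ′ ′ | endCount-copy a t x y ″ ″ | x≢a | y≢a =
    cong₂ _+_ (if-constant (sameColour α k) 0) (cong (_+ 0) (if-constant (sameColour β k) 0))
  colourCopies-away false q {x} {y} {a} α β t k x≢a y≢a
    rewrite label≡copyTag q x | label≡copyTag q y
          | endCount-copy a t x y (copyTag q (covered x)) (copyTag q (covered y)) | x≢a | y≢a =
    cong (_+ 0) (if-constant (sameColour α k) 0)

  colourCopies-first : ∀ p q {a y} α β t k → y ≢ a →
                        colourDegree (colourCopies p q a y α β) (a , t) k ≡ contribution (view p q α β) (covered a) t k
  colourCopies-first true q {a} {y} α β t k y≢a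
    rewrite endCount-copy a t a y ′ ′ | endCount-copy a t a y ″ ″ | N.same-refl a | N.same-≢ y≢a
          | +-identityʳ (𝟙 (sameTag ′ t)) | +-identityʳ (𝟙 (sameTag ″ t)) = 
    cong ((if sameColour α k then 𝟙 (sameTag ′ t) else 0) +_) (+-identityʳ (if sameColour β k then 𝟙 (sameTag ″ t) else 0))
  colourCopies-first false q {a} {y} α β t k y≢a
    rewrite label≡copyTag q a | label≡copyTag q y
          | endCount-copy a t a y (copyTag q (covered a)) (copyTag q (covered y)) | N.same-refl a | N.same-≢ y≢a
          | +-identityʳ (𝟙 (sameTag (copyTag q (covered a)) t)) = +-identityʳ _

  colourCopies-second : ∀ p q {x a} α β t k → x ≢ a →
                         colourDegree (colourCopies p q x a α β) (a , t) k ≡ contribution (view p q α β) (covered a) t k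
  colourCopies-second true q {x} {a} α β t k x≢a
    rewrite endCount-copy a t x a ′ ′ | endCount-copy a t x a ″ ″ | N.same-refl a | N.same-≢ x≢a = 
    cong ((if sameColour α k then 𝟙 (sameTag ′ t) else 0) +_) (+-identityʳ (if sameColour β k then 𝟙 (sameTag ″ t) else 0))
  colourCopies-second false q {x} {a} α β t k x≢a
    rewrite label≡copyTag q x | label≡copyTag q a
          | endCount-copy a t x a (copyTag q (covered x)) (copyTag q (covered a)) | N.same-refl a | N.same-≢ x≢a = +-identityʳ _

  colourCopies-edges : ∀ p q x y α β → map proj₁ (colourCopies p q x y α β) ≡ copiesOf p q x y
  colourCopies-edges true  q x y α β = refl
  colourCopies-edges false q x y α β = refl

  private
    firstColour secondColour : List ColouredEdge → Fin 3
    firstColour (ce ∷ _) = proj₂ ce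
    firstColour []       = zero
    secondColour (_ ∷ ce ∷ _) = proj₂ ce
    secondColour _            = zero

  colourCopies-recover : ∀ p q x y (Y : List ColouredEdge) → map proj₁ Y ≡ copiesOf p q x y →
                          Y ≡ colourCopies p q x y (firstColour Y) (secondColour Y)
  colourCopies-recover true  q x y ((_ , α) ∷ (_ , β) ∷ []) refl = refl
  colourCopies-recover false q x y ((_ , α) ∷ [])           refl = refl

  colourCopiesOf : Edge G → Fin 3 → Fin 3 → List ColouredEdge
  colourCopiesOf e = colourCopies (Ai e) (Aj e) (proj₁ (ends G e)) (proj₂ (ends G e))

  splitColouring : (α β : Edge G → Fin 3) → List ColouredEdge
  splitColouring α β = concatMap (λ e → colourCopiesOf e (α e) (β e)) (allFin _)

  splitColouring-edges : ∀ α β → map proj₁ (splitColouring α β) ≡ edges K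
  splitColouring-edges α β = trans (map-concatMap proj₁ (λ e → colourCopiesOf e (α e) (β e)) (allFin _))
                              (concatMap-cong (λ e → colourCopies-edges (Ai e) (Aj e) _ _ (α e) (β e)) (allFin _))

  colourDegree-splitColouring : ∀ α β w k →
                                colourDegree (splitColouring α β) w k ≡ ∑ (λ e → colourDegree (colourCopiesOf e (α e) (β e)) w k)
  colourDegree-splitColouring α β w k = trans (sum-map-concatMap _ (λ e → colourCopiesOf e (α e) (β e)) (allFin _))
                                              (∑-allFin (λ e → colourDegree (colourCopiesOf e (α e) (β e)) w k))

  splitColouring-complete : SuppressionColouring K → ∃[ α ] ∃[ β ] IsSuppressionColouring K (splitColouring α β)
  splitColouring-complete (CL , lists , sc) = aligned (↭-map-inv proj₁ lists)
    where
    Blocks : List ColouredEdge → Set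
    Blocks Z = ∃[ h ] ((∀ e → map proj₁ (h e) ≡ copies e) × Z ≡ concat (tabulate h))

    byBlocks : ∀ {Z} → Blocks Z → IsSuppressionColouring K Z → ∃[ α ] ∃[ β ] IsSuppressionColouring K (splitColouring α β)
    byBlocks (h , blocks , refl) sc′ = α , β , subst (IsSuppressionColouring K) Z≡ sc′
      where
      α β : Edge G → Fin 3
      α e = firstColour (h e)
      β e = secondColour (h e)
      Z≡ : concat (tabulate h) ≡ splitColouring α β
      Z≡ = trans (cong concat (tabulate-cong λ e → colourCopies-recover (Ai e) (Aj e) _ _ (h e) (blocks e)))
                 (sym (cong concat (map-tabulate id (λ e → colourCopiesOf e (α e) (β e)))))

    aligned : ∃[ Z ] (edges K ≡ map proj₁ Z × CL ↭ Z) → ∃[ α ] ∃[ β ] IsSuppressionColouring K (splitColouring α β)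
    aligned (Z , es≡ , CL↭Z) = byBlocks (map-concat-inv proj₁ copies Z (trans (sym es≡) (cong concat (map-tabulate id copies))))
                                        (isSuppressionColouring-↭ {K} CL↭Z sc)

𝟙+𝟙≡0 : ∀ b b′ → 𝟙 b + 𝟙 b′ ≡ 0 → b ≡ false × b′ ≡ false
𝟙+𝟙≡0 false false _ = refl , refl

module SplitOfCubic (G : MGraph ℕ) (wf : WellFormed G) (cubic : Cubic _≟_ G) (bridgeless : Bridgeless G)
                  (Ai Aj : EdgeSet G) where

  open CubicBridgeless G wf cubic bridgeless
  open Splitting G Ai Aj public
  open Suppression _≟S_

  private
    ∈-vertexCopies⁻ : ∀ c {a : ℕ} {t} {b : ℕ} → (a , t) ∈ (if c then (b , ′) ∷ (b , ″) ∷ [] else (b , o) ∷ []) →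
                      a ≡ b × T (tagPresent c t)
    ∈-vertexCopies⁻ true  (here refl)         = refl , _
    ∈-vertexCopies⁻ true  (there (here refl)) = refl , _
    ∈-vertexCopies⁻ false (here refl)         = refl , _

    ∈-vertexCopies⁺ : ∀ c {a : ℕ} t → T (tagPresent c t) → (a , t) ∈ (if c then (a , ′) ∷ (a , ″) ∷ [] else (a , o) ∷ [])
    ∈-vertexCopies⁺ true  ′ _ = here refl
    ∈-vertexCopies⁺ true  ″ _ = there (here refl)
    ∈-vertexCopies⁺ false o _ = here refl

  vertexCopies : ℕ → List (ℕ × Tag)
  vertexCopies b = if covered b then (b , ′) ∷ (b , ″) ∷ [] else (b , o) ∷ []

  verts-split : ∀ {a t} → (a , t) ∈ verts K ⇔ (a ∈ verts G × T (tagPresent (covered a) t))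
  verts-split {a} {t} = mk⇔ to from
    where
    from : a ∈ verts G × T (tagPresent (covered a) t) → (a , t) ∈ verts K
    from (a∈ , present) =
      ∈-concatMap⁺ vertexCopies (lose {P = λ b → (a , t) ∈ vertexCopies b} a∈ (∈-vertexCopies⁺ (covered a) {a} t present))

    to : (a , t) ∈ verts K → a ∈ verts G × T (tagPresent (covered a) t)
    to m = fromCopy (find (∈-concatMap⁻ vertexCopies {xs = verts G} m))
      where
      fromCopy : ∃[ b ] (b ∈ verts G × (a , t) ∈ vertexCopies b) →
                 a ∈ verts G × T (tagPresent (covered a) t)
      fromCopy (b , b∈ , m′) = same-vertex (∈-vertexCopies⁻ (covered b) {a} {t} {b} m′) b∈
        where
        same-vertex : a ≡ b × T (tagPresent (covered b) t) → b ∈ verts G → a ∈ verts G × T (tagPresent (covered a) t)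
        same-vertex (refl , present) b∈ = b∈ , present

  colourCopiesOf-away : ∀ {a} e α β t k → incidence a e ≡ 0 → colourDegree (colourCopiesOf e α β) (a , t) k ≡ 0
  colourCopiesOf-away {a} e α β t k none = colourCopies-away (Ai e) (Aj e) α β t k (proj₁ away) (proj₂ away)
    where away = 𝟙+𝟙≡0 (N.same (proj₁ (ends G e)) a) (N.same (proj₂ (ends G e)) a) none

  colourCopiesOf-once : ∀ {a} e α β t k → incidence a e ≡ 1 →
                     colourDegree (colourCopiesOf e α β) (a , t) k ≡ contribution (view (Ai e) (Aj e) α β) (covered a) t k
  colourCopiesOf-once {a} e α β t k once = at-end (N.endCount-positive a (ends G e) (subst (0 <_) (sym once) (s≤s z≤n)))
    where
    x = proj₁ (ends G e)
    y = proj₂ (ends G e)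
    Counted : ℕ → ℕ → Set
    Counted x′ y′ = colourDegree (colourCopies (Ai e) (Aj e) x′ y′ α β) (a , t) k ≡ contribution (view (Ai e) (Aj e) α β) (covered a) t k
    at-end : x ≡ a ⊎ y ≡ a → Counted x y
    at-end (inj₁ x≡a) = subst (λ x′ → Counted x′ y) (sym x≡a)
                              (colourCopies-first (Ai e) (Aj e) α β t k (λ y≡a → loopless e (trans x≡a (sym y≡a))))
    at-end (inj₂ y≡a) = subst (λ y′ → Counted x y′) (sym y≡a)
                              (colourCopies-second (Ai e) (Aj e) α β t k (λ x≡a → loopless e (trans x≡a (sym y≡a))))

  valid-outside : ∀ {a} α β t → ¬ (a ∈ verts G) → ValidAt K (colourDegree (splitColouring α β) (a , t)) (a , t)
  valid-outside {a} α β t a∉ =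
    inj₂ ((λ (m , _) → a∉ (proj₁ (Equivalence.to verts-split m))) , λ k → subst (_≤ 1) (sym (none k)) z≤n)
    where
    none : ∀ k → colourDegree (splitColouring α β) (a , t) k ≡ 0
    none k = trans (colourDegree-splitColouring α β (a , t) k)
                   (∑-zero (λ e → colourCopiesOf-away e (α e) (β e) t k (incidence-outside a∉ e)))

  module At {a : ℕ} (a∈ : a ∈ verts G) (α β : Edge G → Fin 3) where

    open Support₃ (threeEdges a∈) public

    viewOf : Edge G → EdgeView
    viewOf e = view (Ai e) (Aj e) (α e) (β e)

    open Local (viewOf e₁) (viewOf e₂) (viewOf e₃) public

    degreeIn-local : ∀ S → degreeIn _≟_ G S a ≡ trues (S e₁) (S e₂) (S e₃)
    degreeIn-local S = trans (degreeIn≡∑ S a)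
      (trans (∑-local (λ e → if S e then incidence a e else 0) (λ e none → N.if-zero (S e) none))
             (cong₂ _+_ (at once₁) (cong₂ _+_ (at once₂) (at once₃))))
      where
      at : ∀ {e} → incidence a e ≡ 1 → (if S e then incidence a e else 0) ≡ 𝟙 (S e)
      at {e} once = cong (λ n → if S e then n else 0) once

    covered-local : covered a ≡ coveredᵇ
    covered-local = cong (λ n → isYes (1 ≤? n)) (degreeIn-local Ai)

    count-local : ∀ t k → colourDegree (splitColouring α β) (a , t) k ≡ count t k
    count-local t k = begin
      colourDegree (splitColouring α β) (a , t) k
        ≡⟨ colourDegree-splitColouring α β (a , t) k ⟩
      ∑ (λ e → colourDegree (colourCopiesOf e (α e) (β e)) (a , t) k)
        ≡⟨ ∑-local _ (λ e → colourCopiesOf-away e (α e) (β e) t k) ⟩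
      _ ≡⟨ cong₂ _+_ (once-at e₁ once₁) (cong₂ _+_ (once-at e₂ once₂) (once-at e₃ once₃)) ⟩
      count t k ∎
      where
      open ≡-Reasoning
      once-at : ∀ e → incidence a e ≡ 1 →
                colourDegree (colourCopiesOf e (α e) (β e)) (a , t) k ≡ contribution (viewOf e) coveredᵇ t k
      once-at e once = trans (colourCopiesOf-once e (α e) (β e) t k once)
                             (cong (λ c → contribution (viewOf e) c t k) covered-local)

    suppressible-local : ∀ t → Suppressible K (a , t) ⇔ T (suppressibleᵇ t)
    suppressible-local t = mk⇔ to from
      where
      degree-local : degree _≟S_ K (a , t) ≡ ∑ (count t)
      degree-local = trans (degree≡∑colourDegree K {splitColouring α β} (↭-reflexive (splitColouring-edges α β)) (a , t))
                           (sum-cong-≗ (count-local t))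
      to : Suppressible K (a , t) → T (suppressibleᵇ t)
      to (m , deg) = Equivalence.from (T-∧ {tagPresent coveredᵇ t})
        (subst (λ c → T (tagPresent c t)) covered-local (proj₂ (Equivalence.to verts-split m)) , ≡⇒≡ᵇ _ 2 (trans (sym degree-local) deg))
      from : T (suppressibleᵇ t) → Suppressible K (a , t)
      from s = let (present , two) = Equivalence.to (T-∧ {tagPresent coveredᵇ t}) s in
        Equivalence.from verts-split (a∈ , subst (λ c → T (tagPresent c t)) (sym covered-local) present) ,
        trans degree-local (≡ᵇ⇒≡ _ 2 two)

    valid-local : ∀ t → ValidAt K (colourDegree (splitColouring α β) (a , t)) (a , t) ⇔ T (validᵇ t)
    valid-local t = ⇔-trans
      (mk⇔ (validAt-transfer {K} {K} ⇔-refl (count-local t))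
           (validAt-transfer {K} {K} ⇔-refl (sym ∘ count-local t)))
      (validAt⇔validCountsᵇ {K} {count t} {a , t} (suppressible-local t))

    CycleUnionAt : Set
    CycleUnionAt = degreeIn _≟_ G Ai a ≤ 1 × degreeIn _≟_ G Aj a ≤ 1 ×
                   (degreeIn _≟_ G (unionₑ G Ai Aj) a ≡ 0 ⊎ degreeIn _≟_ G (unionₑ G Ai Aj) a ≡ 2)

    cycleUnion-local : T cycleUnionᵇ ⇔ CycleUnionAt
    cycleUnion-local = mk⇔ to from
      where
      sA = trues (Ai e₁) (Ai e₂) (Ai e₃)
      sB = trues (Aj e₁) (Aj e₂) (Aj e₃)
      sU = trues (Ai e₁ ∨ Aj e₁) (Ai e₂ ∨ Aj e₂) (Ai e₃ ∨ Aj e₃)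
      to : T cycleUnionᵇ → CycleUnionAt
      to c = let (a≤1 , rest) = Equivalence.to (T-∧ {sA ≤ᵇ 1}) c
                 (b≤1 , cyc) = Equivalence.to (T-∧ {sB ≤ᵇ 1}) rest
             in subst (_≤ 1) (sym (degreeIn-local Ai)) (≤ᵇ⇒≤ _ 1 a≤1) ,
                subst (_≤ 1) (sym (degreeIn-local Aj)) (≤ᵇ⇒≤ _ 1 b≤1) ,
                Data.Sum.map (trans (degreeIn-local (unionₑ G Ai Aj)) ∘ ≡ᵇ⇒≡ _ 0)
                             (trans (degreeIn-local (unionₑ G Ai Aj)) ∘ ≡ᵇ⇒≡ _ 2)
                             (Equivalence.to (T-∨ {sU ≡ᵇ 0}) cyc)
      from : CycleUnionAt → T cycleUnionᵇ
      from (a≤1 , b≤1 , cyc) =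
        Equivalence.from (T-∧ {sA ≤ᵇ 1}) (≤⇒≤ᵇ (subst (_≤ 1) (degreeIn-local Ai) a≤1) ,
        Equivalence.from (T-∧ {sB ≤ᵇ 1}) (≤⇒≤ᵇ (subst (_≤ 1) (degreeIn-local Aj) b≤1) ,
        Equivalence.from (T-∨ {sU ≡ᵇ 0})
          (Data.Sum.map (λ d → ≡⇒≡ᵇ _ 0 (trans (sym (degreeIn-local (unionₑ G Ai Aj))) d))
                        (λ d → ≡⇒≡ᵇ _ 2 (trans (sym (degreeIn-local (unionₑ G Ai Aj))) d)) cyc)))

module FRTripleFromSplitting (G : MGraph ℕ) (wf : WellFormed G) (cubic : Cubic _≟_ G) (bridgeless : Bridgeless G)
                     (Ai Aj : EdgeSet G) (matchingᵢ : Matching _≟_ G Ai) (matchingⱼ : Matching _≟_ G Aj)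
                     (cycles : UnionOfDisjointCycles _≟_ G (unionₑ G Ai Aj))
                     (α β : Edge G → Fin 3)
                     (sc : Suppression.IsSuppressionColouring _≟S_ (split G Ai Aj) (Splitting.splitColouring G Ai Aj α β)) where

  open SplitOfCubic G wf cubic bridgeless Ai Aj

  M : Fin 3 → EdgeSet G
  M k e = inMatching (dropβ (view (Ai e) (Aj e) (α e) (β e))) k

  perfect : ∀ k → PerfectMatching _≟_ G (M k)
  perfect k a a∈ = trans (degreeIn-local (M k))
    (≡ᵇ⇒≡ _ 1 (All.lookup (all⁺ (λ k → trues (M k e₁) (M k e₂) (M k e₃) ≡ᵇ 1) (allFin 3) perfect-local) (∈-allFin k)))
    where
    open At a∈ α β
    valid : ∀ t → t ≢ ″ → T (Local.validᵇ (dropβ (viewOf e₁)) (dropβ (viewOf e₂)) (dropβ (viewOf e₃)) t)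
    valid t t≢″ = subst T (validᵇ-β-irrelevant (viewOf e₁) (viewOf e₂) (viewOf e₃) t t≢″)
                          (Equivalence.to (valid-local t) (sc (a , t)))
    perfect-local : T (perfectAtᵇ (dropβ (viewOf e₁)) (dropβ (viewOf e₂)) (dropβ (viewOf e₃)))
    perfect-local = matchings-local (viewOf e₁) (viewOf e₂) (viewOf e₃)
      (Equivalence.from cycleUnion-local (matchingᵢ a a∈ , matchingⱼ a a∈ , cycles a a∈)) (valid o λ ()) (valid ′ λ ())

  frTriple : FRTriple _≟_ G
  frTriple = M zero , M (suc zero) , M (suc (suc zero)) , perfect zero , perfect (suc zero) , perfect (suc (suc zero)) ,
             λ e → inMatching-notAll (dropβ (view (Ai e) (Aj e) (α e) (β e)))

module SplittingFromFRTriple (G : MGraph ℕ) (wf : WellFormed G) (cubic : Cubic _≟_ G) (bridgeless : Bridgeless G)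
                    (M₁ M₂ M₃ : EdgeSet G) (pm₁ : PerfectMatching _≟_ G M₁) (pm₂ : PerfectMatching _≟_ G M₂)
                    (pm₃ : PerfectMatching _≟_ G M₃) (no-common : ∀ e → (M₁ e ∧ M₂ e ∧ M₃ e) ≡ false) where

  A₁ A₂ : EdgeSet G
  A₁ e = twoOf (M₁ e) (M₂ e) (M₃ e)
  A₂ e = noneOf (M₁ e) (M₂ e) (M₃ e)

  α β : Edge G → Fin 3
  α e = frColour (M₁ e) (M₂ e) (M₃ e)
  β _ = zero

  open SplitOfCubic G wf cubic bridgeless A₁ A₂
  open Suppression _≟S_ using (ValidAt; SuppressionColouring; IsSuppressionColouring; colourDegree)

  module _ {a} (a∈ : a ∈ verts G) where
    open At a∈ α β

    private
      frTripleAt : T (frTripleAtᵇ (M₁ e₁) (M₂ e₁) (M₃ e₁) (M₁ e₂) (M₂ e₂) (M₃ e₂) (M₁ e₃) (M₂ e₃) (M₃ e₃))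
      frTripleAt = Equivalence.from T-∧ (once M₁ pm₁ , Equivalence.from T-∧ (once M₂ pm₂ , Equivalence.from T-∧ (once M₃ pm₃ ,
                   Equivalence.from T-∧ (not-all e₁ , Equivalence.from T-∧ (not-all e₂ , not-all e₃)))))
        where
        once : ∀ S → PerfectMatching _≟_ G S → T (trues (S e₁) (S e₂) (S e₃) ≡ᵇ 1)
        once S pm = ≡⇒≡ᵇ _ 1 (trans (sym (degreeIn-local S)) (pm a a∈))
        not-all : ∀ e → T (not (M₁ e ∧ M₂ e ∧ M₃ e))
        not-all e = Equivalence.from T-not-≡ (no-common e)

      local : T cycleUnionᵇ × T (validᵇ o ∧ (validᵇ ′ ∧ validᵇ ″))
      local = Equivalence.to (T-∧ {cycleUnionᵇ})
                (splitting-local (M₁ e₁) (M₂ e₁) (M₃ e₁) (M₁ e₂) (M₂ e₂) (M₃ e₂) (M₁ e₃) (M₂ e₃) (M₃ e₃) frTripleAt)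

    cycleUnion-at : CycleUnionAt
    cycleUnion-at = Equivalence.to cycleUnion-local (proj₁ local)

    valid-at : ∀ t → T (validᵇ t)
    valid-at o = proj₁ (Equivalence.to (T-∧ {validᵇ o}) (proj₂ local))
    valid-at ′ = proj₁ (Equivalence.to (T-∧ {validᵇ ′}) (proj₂ (Equivalence.to (T-∧ {validᵇ o}) (proj₂ local))))
    valid-at ″ = proj₂ (Equivalence.to (T-∧ {validᵇ ′}) (proj₂ (Equivalence.to (T-∧ {validᵇ o}) (proj₂ local))))

  splitColouring-valid : IsSuppressionColouring (split G A₁ A₂) (splitColouring α β)
  splitColouring-valid (a , t) = by-membership (a ∈? verts G)
    where
    by-membership : Dec (a ∈ verts G) → ValidAt (split G A₁ A₂) (colourDegree (splitColouring α β) (a , t)) (a , t)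
    by-membership (yes a∈) = Equivalence.from (At.valid-local a∈ α β t) (valid-at a∈ t)
    by-membership (no a∉)  = valid-outside α β t a∉

  splitting : Σ (EdgeSet G) λ A₁ → Σ (EdgeSet G) λ A₂ →
                Matching _≟_ G A₁ × Matching _≟_ G A₂ × DisjointEdgeSets G A₁ A₂
                × UnionOfDisjointCycles _≟_ G (unionₑ G A₁ A₂)
                × (SuppressedThreeEdgeColourable _≟S_ (split G A₁ A₂) ⊎ SuppressedThreeEdgeColourable _≟S_ (split G A₂ A₁))
  splitting = A₁ , A₂ , (λ a a∈ → proj₁ (cycleUnion-at a∈)) , (λ a a∈ → proj₁ (proj₂ (cycleUnion-at a∈))) ,
              (λ e → twoOf-noneOf-disjoint (M₁ e) (M₂ e) (M₃ e)) , (λ a a∈ → proj₂ (proj₂ (cycleUnion-at a∈))) ,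
              inj₁ (Equivalence.from (Suppression.suppressedColourable⇔suppressionColouring _≟S_ (split G A₁ A₂))
                                     (splitColouring α β , ↭-reflexive (splitColouring-edges α β) , splitColouring-valid))

degreeIn-cong : ∀ (G : MGraph ℕ) {S S′ : EdgeSet G} → (∀ e → S e ≡ S′ e) → ∀ a → degreeIn _≟_ G S a ≡ degreeIn _≟_ G S′ a
degreeIn-cong G S≗S′ a = cong sum (map-cong (λ e → cong (λ b → if b then endCount _≟_ a (ends G e) else 0) (S≗S′ e)) (allFin _))

frTriple-fromSplitting : ∀ (G : MGraph ℕ) → WellFormed G → Cubic _≟_ G → Bridgeless G → ∀ Ai Aj →
  Matching _≟_ G Ai → Matching _≟_ G Aj → UnionOfDisjointCycles _≟_ G (unionₑ G Ai Aj) →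
  SuppressedThreeEdgeColourable _≟S_ (split G Ai Aj) → FRTriple _≟_ G
frTriple-fromSplitting G wf cubic bridgeless Ai Aj matchingᵢ matchingⱼ cycles colourable =
  let (α , β , sc) = Splitting.splitColouring-complete G Ai Aj
                       (Equivalence.to (Suppression.suppressedColourable⇔suppressionColouring _≟S_ (split G Ai Aj)) colourable)
  in FRTripleFromSplitting.frTriple G wf cubic bridgeless Ai Aj matchingᵢ matchingⱼ cycles α β sc

proposition2p4 : (G : MGraph ℕ) → WellFormed G → Cubic _≟_ G → Bridgeless G →
    (FRTriple _≟_ G
      ⇔ Σ (EdgeSet G) λ A₁ → Σ (EdgeSet G) λ A₂ →
          Matching _≟_ G A₁ × Matching _≟_ G A₂ × DisjointEdgeSets G A₁ A₂
          × UnionOfDisjointCycles _≟_ G (unionₑ G A₁ A₂)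
          × (SuppressedThreeEdgeColourable _≟S_ (split G A₁ A₂)
             ⊎ SuppressedThreeEdgeColourable _≟S_ (split G A₂ A₁)))
proposition2p4 G wf cubic bridgeless = mk⇔
  (λ (M₁ , M₂ , M₃ , pm₁ , pm₂ , pm₃ , no-common) →
     SplittingFromFRTriple.splitting G wf cubic bridgeless M₁ M₂ M₃ pm₁ pm₂ pm₃ no-common)
  λ where
    (A₁ , A₂ , m₁ , m₂ , _ , cycles , inj₁ colourable) →
      frTriple-fromSplitting G wf cubic bridgeless A₁ A₂ m₁ m₂ cycles colourable
    (A₁ , A₂ , m₁ , m₂ , _ , cycles , inj₂ colourable) →
      frTriple-fromSplitting G wf cubic bridgeless A₂ A₁ m₂ m₁
        (λ a a∈ → subst (λ d → d ≡ 0 ⊎ d ≡ 2) (degreeIn-cong G (λ e → ∨-comm (A₁ e) (A₂ e)) a) (cycles a a∈)) colourable
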